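{- Let $G$ be a finite graph and $F$ a field of characteristic $0$. For each integer $k \ge 0$ let $V_k$ be the $F$-vector space with basis $\{x_M\}$ indexed by the set $\mathbf{M}_k$ of $k$-matchings of $G$ (so $V_0$ is spanned by $x_{\varnothing}$, and $V_k = 0$ when $G$ has no $k$-matching), and let $\operatorname{Aut}(G)$ act on $V_k$ by $\sigma \cdot x_M = x_{\sigma(M)}$. Then the graded $\operatorname{Aut}(G)$-representation $V_G^{\bullet} = \bigoplus_{k \ge 0} V_k$ is strongly $\operatorname{Aut}(G)$-equivariantly log-concave: for all integers $1 \le \ell \le k$ there exists an injective $\operatorname{Aut}(G)$-equivariant $F$-linear map $V_{\ell-1} \otimes V_{k+1} \hookrightarrow V_{\ell} \otimes V_k$.
   Context: A matching (or $k$-matching) in $G$ is a set of $k$ pairwise non-adjacent edges (no two share a vertex). $\operatorname{Aut}(G)$ is the automorphism group of $G$; an automorphism $\sigma$ maps edges to edges and hence matchings to matchings, $\sigma(M) = \{\sigma(e) : e \in M\}$. The group acts on tensor products diagonally: $\sigma\cdot(x_M \otimes x_{M'}) = x_{\sigma(M)} \otimes x_{\sigma(M')}$. -}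

module Defs where

open import Level using (Level; _⊔_)
open import Data.Nat using (ℕ; _<ᵇ_)
import Data.Nat as N
open import Data.Bool using (Bool; true; false; _∧_; if_then_else_)
open import Data.Fin using (Fin; toℕ)
open import Data.Vec using (Vec; lookup; tabulate)
open import Data.List using (map; allFin)
open import Data.Nat.ListAction using (sum)
open import Data.Product using (Σ; _×_; _,_; proj₁; proj₂)
open import Data.Fin.Permutation using (Permutation′; _⟨$⟩ʳ_)
open import Relation.Binary.PropositionalEquality using (_≡_)
open import Relation.Nullary using (¬_)
open import Algebra.Bundles using (CommutativeRing; Semiring)
import Algebra.Definitions.RawSemiring as RS

record Field (c ℓ : Level) : Set (Level.suc (c ⊔ ℓ)) where
  field
    commutativeRing : CommutativeRing c ℓ
  open CommutativeRing commutativeRing public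
  field
    0≉1     : ¬ (0# ≈ 1#)
    inverse : ∀ x → ¬ (x ≈ 0#) → Σ Carrier (λ y → (x * y) ≈ 1#)

  open RS (Semiring.rawSemiring semiring) public using () renaming (_×_ to _·ℕ_)

CharZero : ∀ {c ℓ} → Field c ℓ → Set ℓ
CharZero F = ∀ (n : ℕ) → ¬ ((N.suc n ·ℕ 1#) ≈ 0#)
  where open Field F

record Graph : Set where
  field
    n      : ℕ
    adj    : Fin n → Fin n → Bool
    sym    : ∀ i j → adj i j ≡ adj j i
    irrefl : ∀ i → adj i i ≡ false

IsAut : (G : Graph) → Permutation′ (Graph.n G) → Set
IsAut G σ = ∀ i j → adj (σ ⟨$⟩ʳ i) (σ ⟨$⟩ʳ j) ≡ adj i j
  where open Graph G

-- Edge subsets, encoded canonically as symmetric n×n Boolean matrices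
-- (entry i j = true  iff  {i,j} is in the set).

Mat : ℕ → Set
Mat n = Vec (Vec Bool n) n

entry : ∀ {n} → Mat n → Fin n → Fin n → Bool
entry N i j = lookup (lookup N i) j

edgeCount : ∀ {n} → Mat n → ℕ
edgeCount {n} N =
  sum (map (λ i → sum (map (λ j → if (toℕ i <ᵇ toℕ j) ∧ entry N i j then 1 else 0)
                           (allFin n)))
           (allFin n))

record IsMatching (G : Graph) (k : ℕ) (N : Mat (Graph.n G)) : Set where
  open Graph G
  field
    symmetric : ∀ i j → entry N i j ≡ entry N j i
    edges     : ∀ i j → entry N i j ≡ true → adj i j ≡ true
    disjoint  : ∀ i j j′ → entry N i j ≡ true → entry N i j′ ≡ true → j ≡ j′
    size      : edgeCount N ≡ k

-- action of a permutation on edge sets, σ(M) = {σ(e) : e ∈ M};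
-- here we use the inverse action M ↦ σ⁻¹(M), whose entries are
-- (σ⁻¹ M) i j = M (σ i) (σ j).
actInv : ∀ {n} → Permutation′ n → Mat n → Mat n
actInv σ N = tabulate (λ i → tabulate (λ j → entry N (σ ⟨$⟩ʳ i) (σ ⟨$⟩ʳ j)))

-- V_a has basis {x_M : M a-matching}; V_a ⊗ V_b has basis
-- {x_M ⊗ x_M'}.  An element is given by its coefficient function on
-- pairs (M , M') of edge sets, required to vanish off the basis
-- (i.e. unless M is an a-matching and M' a b-matching).

module _ {c ℓ} (F : Field c ℓ) (G : Graph) where
  open Field F
  open Graph G

  Coeff : Set c
  Coeff = Mat n × Mat n → Carrier

  InTensor : ℕ → ℕ → Coeff → Set ℓ
  InTensor a b f = ∀ p → ¬ (IsMatching G a (proj₁ p) × IsMatching G b (proj₂ p)) → f p ≈ 0#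

  _≐_ : Coeff → Coeff → Set ℓ
  f ≐ g = ∀ p → f p ≈ g p

  _⊕_ : Coeff → Coeff → Coeff
  (f ⊕ g) p = f p + g p

  _⊙_ : Carrier → Coeff → Coeff
  (a ⊙ f) p = a * f p

  -- diagonal action: σ · (Σ f(M,M') x_M ⊗ x_M') = Σ f(M,M') x_σM ⊗ x_σM',
  -- i.e. (σ · f)(N , N') = f (σ⁻¹ N , σ⁻¹ N')
  act : Permutation′ n → Coeff → Coeff
  act σ f (N , N′) = f (actInv σ N , actInv σ N′)

  record InjEquivLinMap (a b a′ b′ : ℕ) : Set (c ⊔ ℓ) where
    field
      φ           : Coeff → Coeff
      into        : ∀ f → InTensor a b f → InTensor a′ b′ (φ f)
      respects    : ∀ f g → InTensor a b f → InTensor a b g → f ≐ g → φ f ≐ φ g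
      additive    : ∀ f g → InTensor a b f → InTensor a b g → φ (f ⊕ g) ≐ (φ f ⊕ φ g)
      homogeneous : ∀ s f → InTensor a b f → φ (s ⊙ f) ≐ (s ⊙ φ f)
      injective   : ∀ f g → InTensor a b f → InTensor a b g → φ f ≐ φ g → f ≐ g
      equivariant : ∀ σ → IsAut G σ → ∀ f → InTensor a b f → φ (act σ f) ≐ act σ (φ f)

module Submission where

-- For a pair of matchings (M , M′) every vertex has degree at most 2 in M ∪ M′, so the union
-- splits into alternating paths and cycles.  Exchanging M and M′ along a path component whose
-- two end edges lie in M′ moves one edge from M′ to M; summing over such components defines an
-- Aut(G)-equivariant map U : V_a ⊗ V_(b+1) → V_(a+1) ⊗ V_b, and exchanging along paths with both
-- end edges in M gives D in the other direction.  Counting path ends, #(M-ended paths) −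
-- #(M′-ended paths) = |M| − |M′|, and since each path is reached from both of its ends this gives
-- DU − UD = 4(b − a) on V_a ⊗ V_b.  As for sl₂, in characteristic 0 this forces U to be injective
-- on V_a ⊗ V_b whenever a < b; the theorem is the case a = l − 1, b = k + 1.

open import Defs

module Combinatorics where

  open import Data.Nat as ℕ using (ℕ; zero; suc; _+_; _*_; _≤_; _<_; z≤n; s≤s; _<ᵇ_)
  open import Data.Nat.Properties hiding (_≟_; suc-injective)
  open import Data.Bool as Bool using (Bool; true; false; _∧_; _∨_; not; if_then_else_)
  open import Data.Bool.Properties using (∨-comm; ∧-identityʳ; not-involutive; not-injective; not-¬; ¬-not)
  open import Data.Fin as Fin using (Fin; zero; suc; toℕ; fromℕ<)
  open import Data.Fin.Properties using (suc-injective; toℕ-injective; pigeonhole; toℕ<n; toℕ-fromℕ<; all?)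
  open import Data.Fin.Permutation using (Permutation′; _⟨$⟩ʳ_; _⟨$⟩ˡ_; inverseʳ; inverseˡ)
  open import Data.Maybe as Maybe using (Maybe; just; nothing)
  open import Data.Product using (∃; _×_; _,_; proj₁; proj₂; swap)
  open import Data.Sum using (_⊎_; inj₁; inj₂)
  open import Data.Empty using (⊥; ⊥-elim)
  open import Function using (_∘_; id)
  open import Relation.Nullary using (¬_; yes; no; Dec; ofʸ; ofⁿ)
  open import Relation.Nullary.Decidable using (⌊_⌋)
  open import Relation.Binary using (tri<; tri≈; tri>)
  open import Relation.Binary.PropositionalEquality
  open import Algebra.Properties.CommutativeMonoid.Sum +-0-commutativeMonoid
    using () renaming (sum to ∑ℕ; sum-cong-≋ to ∑ℕ-cong; ∑-distrib-+ to ∑ℕ-distrib-+;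
                       ∑-comm to ∑ℕ-comm; sum-replicate-zero to ∑ℕ-zero)

  ∨-introˡ : ∀ {a b} → a ≡ true → a ∨ b ≡ true
  ∨-introˡ refl = refl

  ∨-introʳ : ∀ {a b} → b ≡ true → a ∨ b ≡ true
  ∨-introʳ {true}  _ = refl
  ∨-introʳ {false} e = e

  ∨-elim : ∀ {a b} → a ∨ b ≡ true → a ≡ true ⊎ b ≡ true
  ∨-elim {true}  _ = inj₁ refl
  ∨-elim {false} e = inj₂ e

  ∧-intro : ∀ {a b} → a ≡ true → b ≡ true → a ∧ b ≡ true
  ∧-intro refl refl = refl

  ∧-elimˡ : ∀ {a b} → a ∧ b ≡ true → a ≡ true
  ∧-elimˡ {true} _ = refl

  ∧-elimʳ : ∀ {a b} → a ∧ b ≡ true → b ≡ true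
  ∧-elimʳ {true} e = e

  not-true : ∀ {a} → not a ≡ true → a ≡ false
  not-true {false} _ = refl

  not-false : ∀ {a} → a ≡ false → not a ≡ true
  not-false refl = refl

  ≢true : ∀ {a} → ¬ a ≡ true → a ≡ false
  ≢true {true}  h = ⊥-elim (h refl)
  ≢true {false} _ = refl

  ≢false : ∀ {a} → ¬ a ≡ false → a ≡ true
  ≢false {true}  _ = refl
  ≢false {false} h = ⊥-elim (h refl)

  true≢false : true ≢ false
  true≢false ()

  ≡-by-⇔ : ∀ {a b} → (a ≡ true → b ≡ true) → (b ≡ true → a ≡ true) → a ≡ b
  ≡-by-⇔ {true}  {true}  _ _ = refl
  ≡-by-⇔ {true}  {false} f _ = sym (f refl)
  ≡-by-⇔ {false} {true}  _ g = g refl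
  ≡-by-⇔ {false} {false} _ _ = refl

  toℕᵇ : Bool → ℕ
  toℕᵇ true  = 1
  toℕᵇ false = 0

  toℕᵇ≤1 : ∀ b → toℕᵇ b ≤ 1
  toℕᵇ≤1 true  = s≤s z≤n
  toℕᵇ≤1 false = z≤n

  toℕᵇ-mono : ∀ {a b} → (a ≡ true → b ≡ true) → toℕᵇ a ≤ toℕᵇ b
  toℕᵇ-mono {true}  f rewrite f refl = ≤-refl
  toℕᵇ-mono {false} _ = z≤n

  anyᵇ : ∀ {m} → (Fin m → Bool) → Bool
  anyᵇ {zero}  p = false
  anyᵇ {suc m} p = p zero ∨ anyᵇ (p ∘ suc)

  anyᵇ-intro : ∀ {m} (p : Fin m → Bool) i → p i ≡ true → anyᵇ p ≡ true
  anyᵇ-intro p zero    e = ∨-introˡ e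
  anyᵇ-intro p (suc i) e = ∨-introʳ {p zero} (anyᵇ-intro (p ∘ suc) i e)

  anyᵇ-witness : ∀ {m} (p : Fin m → Bool) → anyᵇ p ≡ true → ∃ λ i → p i ≡ true
  anyᵇ-witness {suc m} p e with ∨-elim {p zero} e
  ... | inj₁ e₀ = zero , e₀
  ... | inj₂ e₁ with anyᵇ-witness (p ∘ suc) e₁
  ... | i , q = suc i , q

  anyᵇ-false : ∀ {m} (p : Fin m → Bool) → anyᵇ p ≡ false → ∀ i → p i ≡ false
  anyᵇ-false p e i = ≢true λ q → true≢false (trans (sym (anyᵇ-intro p i q)) e)

  anyᵇ-cong : ∀ {m} {p q : Fin m → Bool} → (∀ i → p i ≡ q i) → anyᵇ p ≡ anyᵇ q
  anyᵇ-cong {zero}  h = refl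
  anyᵇ-cong {suc m} h = cong₂ _∨_ (h zero) (anyᵇ-cong (h ∘ suc))

  anyᵇ-permute : ∀ {m} (π : Permutation′ m) (p : Fin m → Bool) → anyᵇ (λ i → p (π ⟨$⟩ʳ i)) ≡ anyᵇ p
  anyᵇ-permute π p = ≡-by-⇔
    (λ e → let (i , q) = anyᵇ-witness (λ i → p (π ⟨$⟩ʳ i)) e in anyᵇ-intro p _ q)
    (λ e → let (i , q) = anyᵇ-witness p e in
           anyᵇ-intro (λ i → p (π ⟨$⟩ʳ i)) (π ⟨$⟩ˡ i) (trans (cong p (inverseʳ π)) q))

  _==_ : ∀ {m} → Fin m → Fin m → Bool
  a == b = ⌊ a Fin.≟ b ⌋

  ==-sound : ∀ {m} {a b : Fin m} → a == b ≡ true → a ≡ b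
  ==-sound {a = a} {b} e with a Fin.≟ b
  ... | yes p = p

  ==-refl : ∀ {m} (a : Fin m) → a == a ≡ true
  ==-refl a with a Fin.≟ a
  ... | yes _ = refl
  ... | no a≢a = ⊥-elim (a≢a refl)

  first : ∀ {m} → (Fin m → Bool) → Maybe (Fin m)
  first {zero}  p = nothing
  first {suc m} p with p zero
  ... | true  = just zero
  ... | false = Maybe.map suc (first (p ∘ suc))

  first-just : ∀ {m} (p : Fin m → Bool) {j} → first p ≡ just j → p j ≡ true
  first-just {suc m} p e with p zero in e₀
  first-just {suc m} p refl | true = e₀
  ... | false with first (p ∘ suc) in e₁
  first-just {suc m} p refl | false | just i = first-just (p ∘ suc) e₁

  first-none : ∀ {m} (p : Fin m → Bool) → first p ≡ nothing → ∀ j → p j ≡ false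
  first-none {suc m} p e j with p zero in e₀
  first-none {suc m} p () j | true
  ... | false with first (p ∘ suc) in e₁
  first-none {suc m} p () j       | false | just _
  first-none {suc m} p e zero    | false | nothing = e₀
  first-none {suc m} p e (suc j) | false | nothing = first-none (p ∘ suc) e₁ j

  first-nothing : ∀ {m} (p : Fin m → Bool) → anyᵇ p ≡ false → first p ≡ nothing
  first-nothing p e with first p in e₁
  ... | nothing = refl
  ... | just j = ⊥-elim (true≢false (trans (sym (anyᵇ-intro p j (first-just p e₁))) e))

  first-unique : ∀ {m} (p : Fin m → Bool) → (∀ j j′ → p j ≡ true → p j′ ≡ true → j ≡ j′) →
                 ∀ j → p j ≡ true → first p ≡ just j
  first-unique p unique j pj with first p in e
  ... | just i  = cong just (unique i j (first-just p e) pj)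
  ... | nothing = ⊥-elim (true≢false (trans (sym pj) (first-none p e j)))

  ∑ℕ-mono-≤ : ∀ {m} {f g : Fin m → ℕ} → (∀ i → f i ≤ g i) → ∑ℕ f ≤ ∑ℕ g
  ∑ℕ-mono-≤ {zero}  h = z≤n
  ∑ℕ-mono-≤ {suc m} h = +-mono-≤ (h zero) (∑ℕ-mono-≤ (h ∘ suc))

  ∑ℕ-pointwise : ∀ {m} {f g h k : Fin m → ℕ} → (∀ i → f i + g i ≡ h i + k i) → ∑ℕ f + ∑ℕ g ≡ ∑ℕ h + ∑ℕ k
  ∑ℕ-pointwise {f = f} {g} {h} {k} e = trans (sym (∑ℕ-distrib-+ f g)) (trans (∑ℕ-cong e) (∑ℕ-distrib-+ h k))

  count : ∀ {m} → (Fin m → Bool) → ℕ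
  count p = ∑ℕ (toℕᵇ ∘ p)

  count-cong : ∀ {m} {p q : Fin m → Bool} → (∀ i → p i ≡ q i) → count p ≡ count q
  count-cong h = ∑ℕ-cong (cong toℕᵇ ∘ h)

  count-≤ : ∀ {m} (p : Fin m → Bool) → count p ≤ m
  count-≤ {zero}  p = z≤n
  count-≤ {suc m} p = +-mono-≤ (toℕᵇ≤1 (p zero)) (count-≤ (p ∘ suc))

  count-mono : ∀ {m} {p q : Fin m → Bool} → (∀ i → p i ≡ true → q i ≡ true) → count p ≤ count q
  count-mono h = ∑ℕ-mono-≤ (toℕᵇ-mono ∘ h)

  count-mono-< : ∀ {m} {p q : Fin m → Bool} → (∀ i → p i ≡ true → q i ≡ true) →
                 ∀ y → p y ≡ false → q y ≡ true → count p < count q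
  count-mono-< {suc m} {p} {q} h zero    py qy rewrite py | qy = s≤s (count-mono (h ∘ suc))
  count-mono-< {suc m} {p} {q} h (suc y) py qy =
    ≤-trans (≤-reflexive (sym (+-suc (toℕᵇ (p zero)) (count (p ∘ suc)))))
            (+-mono-≤ (toℕᵇ-mono (h zero)) (count-mono-< (h ∘ suc) y py qy))

  count-none : ∀ {m} (p : Fin m → Bool) → (∀ i → p i ≡ false) → count p ≡ 0
  count-none {m} p h = trans (count-cong h) (∑ℕ-zero m)

  count-pos : ∀ {m} (p : Fin m → Bool) x → p x ≡ true → 1 ≤ count p
  count-pos {suc m} p zero    e rewrite e = s≤s z≤n
  count-pos {suc m} p (suc x) e = ≤-trans (count-pos (p ∘ suc) x e) (m≤n+m _ (toℕᵇ (p zero)))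

  count-unique : ∀ {m} (p : Fin m → Bool) → (∀ j j′ → p j ≡ true → p j′ ≡ true → j ≡ j′) →
                 count p ≡ toℕᵇ (anyᵇ p)
  count-unique {zero}  p unique = refl
  count-unique {suc m} p unique with p zero in e₀
  ... | true  = cong suc (count-none (p ∘ suc) λ i → ≢true λ eᵢ → 0≢suc (unique zero (suc i) e₀ eᵢ))
    where
    0≢suc : ∀ {i : Fin m} → zero ≢ suc i
    0≢suc ()
  ... | false = count-unique (p ∘ suc) (λ j j′ a b → suc-injective (unique (suc j) (suc j′) a b))

  count-== : ∀ {m} (a : Fin m) → count (a ==_) ≡ 1
  count-== a = trans (count-unique (a ==_) (λ j j′ x y → trans (sym (==-sound x)) (==-sound y)))
                     (cong toℕᵇ (anyᵇ-intro (a ==_) a (==-refl a)))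

  count≤1 : ∀ {m} (p : Fin m → Bool) → count p ≤ 1 → count p ≡ toℕᵇ (anyᵇ p)
  count≤1 p le with anyᵇ p in e
  ... | false = count-none p (anyᵇ-false p e)
  ... | true with anyᵇ-witness p e
  ... | x , px = ≤-antisym le (count-pos p x px)

  module MatchingPairs (G : Graph) where

    open import Data.Vec using (lookup; tabulate)
    open import Data.Vec.Properties using (lookup∘tabulate; tabulate∘lookup; tabulate-cong)
    open import Relation.Nullary.Decidable using (_×-dec_; _→-dec_)
    open Graph G using (n; adj; irrefl)

    -- (M , M′) stands for the basis tensor x_M ⊗ x_M′; superscripts ˡ and ʳ refer to M and M′.
    Pair : Set
    Pair = Mat n × Mat n

    fromEntries : (Fin n → Fin n → Bool) → Mat n
    fromEntries g = tabulate λ i → tabulate λ j → g i j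

    entry-fromEntries : ∀ g i j → entry (fromEntries g) i j ≡ g i j
    entry-fromEntries g i j = trans (cong (λ r → lookup r j) (lookup∘tabulate _ i)) (lookup∘tabulate _ j)

    Mat-ext : ∀ {A B : Mat n} → (∀ i j → entry A i j ≡ entry B i j) → A ≡ B
    Mat-ext {A} {B} h = trans (sym (fromEntries-entry A)) (trans (tabulate-cong (tabulate-cong ∘ h)) (fromEntries-entry B))
      where
      fromEntries-entry : ∀ M → fromEntries (entry M) ≡ M
      fromEntries-entry M = trans (tabulate-cong (tabulate∘lookup ∘ lookup M)) (tabulate∘lookup M)

    Matching : Mat n → Set
    Matching M = (∀ i j → entry M i j ≡ entry M j i)
               × (∀ i j → entry M i j ≡ true → adj i j ≡ true)
               × (∀ i j j′ → entry M i j ≡ true → entry M i j′ ≡ true → j ≡ j′)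

    matching? : ∀ M → Dec (Matching M)
    matching? M =
          all? (λ i → all? (λ j → entry M i j Bool.≟ entry M j i))
      ×-dec all? (λ i → all? (λ j → (entry M i j Bool.≟ true) →-dec (adj i j Bool.≟ true)))
      ×-dec all? (λ i → all? (λ j → all? (λ j′ →
              (entry M i j Bool.≟ true) →-dec ((entry M i j′ Bool.≟ true) →-dec (j Fin.≟ j′)))))

    Matching-irrefl : ∀ {M} → Matching M → ∀ i → entry M i i ≡ false
    Matching-irrefl (_ , edge , _) i = ≢true λ e → true≢false (trans (sym (edge i i e)) (irrefl i))

    MatchingPair : Pair → Set
    MatchingPair (M , M′) = Matching M × Matching M′

    matchingPair? : ∀ s → Dec (MatchingPair s)
    matchingPair? (M , M′) = matching? M ×-dec matching? M′

    isMatchingPair : Pair → Bool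
    isMatchingPair s = ⌊ matchingPair? s ⌋

    isMatchingPair-true : ∀ {s} → MatchingPair s → isMatchingPair s ≡ true
    isMatchingPair-true {s} ms with matchingPair? s
    ... | yes _ = refl
    ... | no ¬ms = ⊥-elim (¬ms ms)

    isMatchingPair-false : ∀ {s} → ¬ MatchingPair s → isMatchingPair s ≡ false
    isMatchingPair-false {s} ¬ms with matchingPair? s
    ... | yes ms = ⊥-elim (¬ms ms)
    ... | no _ = refl

    isMatchingPair-sound : ∀ {s} → isMatchingPair s ≡ true → MatchingPair s
    isMatchingPair-sound {s} e with matchingPair? s
    ... | yes ms = ms

    joined : Pair → Fin n → Fin n → Bool
    joined (M , M′) x y = entry M x y ∨ entry M′ x y

    joined-sym : ∀ s → MatchingPair s → ∀ x y → joined s x y ≡ joined s y x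
    joined-sym _ ((symM , _) , (symM′ , _)) x y = cong₂ _∨_ (symM x y) (symM′ x y)

    coveredˡ coveredʳ onlyˡ onlyʳ leaf : Pair → Fin n → Bool
    coveredˡ (M , _) x = anyᵇ (entry M x)
    coveredʳ (_ , M′) x = anyᵇ (entry M′ x)
    onlyˡ s x = coveredˡ s x ∧ not (coveredʳ s x)
    onlyʳ s x = coveredʳ s x ∧ not (coveredˡ s x)
    leaf s x = onlyˡ s x ∨ onlyʳ s x

    _∩_ : (Fin n → Bool) → (Fin n → Bool) → Fin n → Bool
    (S ∩ p) x = S x ∧ p x

    -- Connected components of M ∪ M′

    reach : Pair → ℕ → Fin n → Fin n → Bool
    reach s zero    v x = v == x
    reach s (suc k) v x = reach s k v x ∨ anyᵇ (λ y → reach s k v y ∧ joined s y x)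

    component : Pair → Fin n → Fin n → Bool
    component s = reach s n

    Closed : Pair → (Fin n → Bool) → Set
    Closed s S = ∀ x y → S x ≡ true → joined s x y ≡ true → S y ≡ true

    reach-minimal : ∀ s (S : Fin n → Bool) v → Closed s S → S v ≡ true → ∀ k x → reach s k v x ≡ true → S x ≡ true
    reach-minimal s S v closed Sv zero    x e rewrite ==-sound e = Sv
    reach-minimal s S v closed Sv (suc k) x e with ∨-elim e
    ... | inj₁ e₁ = reach-minimal s S v closed Sv k x e₁
    ... | inj₂ e₂ with anyᵇ-witness _ e₂
    ... | y , q = closed y x (reach-minimal s S v closed Sv k y (∧-elimˡ q)) (∧-elimʳ q)

    reach-refl : ∀ s k v → reach s k v v ≡ true
    reach-refl s zero    v = ==-refl v
    reach-refl s (suc k) v = ∨-introˡ (reach-refl s k v)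

    reach-extend : ∀ s k v x y → reach s k v x ≡ true → joined s x y ≡ true → reach s (suc k) v y ≡ true
    reach-extend s k v x y e a = ∨-introʳ (anyᵇ-intro _ x (∧-intro e a))

    reach-grows-or-closed : ∀ s v k → suc k ≤ count (reach s k v) ⊎ Closed s (reach s k v)
    reach-grows-or-closed s v zero = inj₁ (≤-reflexive (sym (count-== v)))
    reach-grows-or-closed s v (suc k) with reach-grows-or-closed s v k
    ... | inj₂ closed = inj₂ λ x y ex a →
          ∨-introˡ (closed x y (reach-minimal s (reach s k v) v closed (reach-refl s k v) (suc k) x ex) a)
    ... | inj₁ grows with anyᵇ (λ x → reach s (suc k) v x ∧ not (reach s k v x)) in new
    ... | true  = let (x , q) = anyᵇ-witness _ new in
                  inj₁ (≤-trans (s≤s grows) (count-mono-< {p = reach s k v} {q = reach s (suc k) v}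
                                                           (λ _ → ∨-introˡ) x (not-true (∧-elimʳ q)) (∧-elimˡ q)))
    ... | false = inj₂ λ x y ex a → ∨-introˡ (old y (reach-extend s k v x y (old x ex) a))
      where
      old : ∀ x → reach s (suc k) v x ≡ true → reach s k v x ≡ true
      old x ex = ≢false λ e → true≢false (trans (sym (anyᵇ-intro _ x (∧-intro ex (not-false e)))) new)

    component-closed : ∀ s v → Closed s (component s v)
    component-closed s v with reach-grows-or-closed s v n
    ... | inj₂ closed = closed
    ... | inj₁ grows  = ⊥-elim (<-irrefl refl (≤-trans grows (count-≤ (component s v))))

    component-refl : ∀ s v → component s v v ≡ true
    component-refl s = reach-refl s n

    component-minimal : ∀ s (S : Fin n → Bool) v → Closed s S → S v ≡ true → ∀ x → component s v x ≡ true → S x ≡ true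
    component-minimal s S v closed Sv = reach-minimal s S v closed Sv n

    component-cong : ∀ {s t} → (∀ x y → joined s x y ≡ joined t x y) → ∀ v x → component s v x ≡ component t v x
    component-cong {s} {t} h = reach-cong n
      where
      reach-cong : ∀ k v x → reach s k v x ≡ reach t k v x
      reach-cong zero    v x = refl
      reach-cong (suc k) v x = cong₂ _∨_ (reach-cong k v x) (anyᵇ-cong (λ y → cong₂ _∧_ (reach-cong k v y) (h y x)))

    module _ (s : Pair) (ms : MatchingPair s) where

      component-sym : ∀ v u → component s v u ≡ true → component s u v ≡ true
      component-sym v u e = ≢false λ e₂ → true≢false (trans (sym (component-refl s u)) (not-true (∧-elimʳ (u∈S e₂))))
        where
        S : Fin n → Bool
        S x = component s v x ∧ not (component s u x)
        S-closed : component s u v ≡ false → Closed s S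
        S-closed e₂ x y Sx a = ∧-intro (component-closed s v x y (∧-elimˡ Sx) a) (not-false (≢true λ e₄ →
          true≢false (trans (sym (component-closed s u y x e₄ (trans (joined-sym s ms y x) a))) (not-true (∧-elimʳ Sx)))))
        u∈S : component s u v ≡ false → S u ≡ true
        u∈S e₂ = component-minimal s S v (S-closed e₂) (∧-intro (component-refl s v) (not-false e₂)) u e

      component-same : ∀ v u → component s v u ≡ true → ∀ x → component s u x ≡ component s v x
      component-same v u e x = ≡-by-⇔ (component-minimal s (component s v) u (component-closed s v) e x)
                                      (component-minimal s (component s u) v (component-closed s u) (component-sym v u e) x)

      component-disjoint : ∀ v u → component s v u ≡ false → ∀ x → component s v x ≡ true → component s u x ≡ false
      component-disjoint v u e x cx = ≢true λ e₂ →
        true≢false (trans (sym (trans (sym (component-same v x cx u)) (component-sym u x e₂))) e)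

    select : (Fin n → Bool) → Mat n → Mat n → Mat n
    select S A B = fromEntries λ i j → if S i then entry A i j else entry B i j

    swapOn : (Fin n → Bool) → Pair → Pair
    swapOn S (M , M′) = select S M′ M , select S M M′

    entry-select : ∀ S A B i j → entry (select S A B) i j ≡ (if S i then entry A i j else entry B i j)
    entry-select S A B = entry-fromEntries _

    anyᵇ-select : ∀ S A B x → anyᵇ (entry (select S A B) x) ≡ (if S x then anyᵇ (entry A x) else anyᵇ (entry B x))
    anyᵇ-select S A B x with S x in e
    ... | true  = anyᵇ-cong λ j → trans (entry-select S A B x j) (cong (if_then entry A x j else entry B x j) e)
    ... | false = anyᵇ-cong λ j → trans (entry-select S A B x j) (cong (if_then entry A x j else entry B x j) e)

    joined-swapOn : ∀ S s x y → joined (swapOn S s) x y ≡ joined s x y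
    joined-swapOn S (M , M′) x y rewrite entry-select S M′ M x y | entry-select S M M′ x y with S x
    ... | true  = ∨-comm (entry M′ x y) (entry M x y)
    ... | false = refl

    component-swapOn : ∀ S s v x → component (swapOn S s) v x ≡ component s v x
    component-swapOn S s = component-cong (joined-swapOn S s)

    onlyˡ-swapOn : ∀ S s x → onlyˡ (swapOn S s) x ≡ (if S x then onlyʳ s x else onlyˡ s x)
    onlyˡ-swapOn S (M , M′) x rewrite anyᵇ-select S M′ M x | anyᵇ-select S M M′ x with S x
    ... | true  = refl
    ... | false = refl

    onlyʳ-swapOn : ∀ S s x → onlyʳ (swapOn S s) x ≡ (if S x then onlyˡ s x else onlyʳ s x)
    onlyʳ-swapOn S (M , M′) x rewrite anyᵇ-select S M′ M x | anyᵇ-select S M M′ x with S x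
    ... | true  = refl
    ... | false = refl

    swapOn-involutive : ∀ S s → swapOn S (swapOn S s) ≡ s
    swapOn-involutive S (M , M′) = cong₂ _,_ (Mat-ext (select-twice M′ M)) (Mat-ext (select-twice M M′))
      where
      select-twice : ∀ A B i j → entry (select S (select S B A) (select S A B)) i j ≡ entry B i j
      select-twice A B i j rewrite entry-select S (select S B A) (select S A B) i j
                                 | entry-select S A B i j | entry-select S B A i j with S i
      ... | true  = refl
      ... | false = refl

    swapOn-comm : ∀ S T s → (∀ x → S x ∧ T x ≡ false) → swapOn S (swapOn T s) ≡ swapOn T (swapOn S s)
    swapOn-comm S T (M , M′) disjoint = cong₂ _,_ (Mat-ext (select-comm M′ M)) (Mat-ext (select-comm M M′))
      where
      select-comm : ∀ A B i j → entry (select S (select T B A) (select T A B)) i j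
                              ≡ entry (select T (select S B A) (select S A B)) i j
      select-comm A B i j
        rewrite entry-select S (select T B A) (select T A B) i j | entry-select T (select S B A) (select S A B) i j
              | entry-select T B A i j | entry-select T A B i j | entry-select S B A i j | entry-select S A B i j
        with S i in eS | T i in eT
      ... | true  | true  = ⊥-elim (true≢false (trans (sym (cong₂ _∧_ eS eT)) (disjoint i)))
      ... | true  | false = refl
      ... | false | true  = refl
      ... | false | false = refl

    swapOn-cong : ∀ {S T} s → (∀ x → S x ≡ T x) → swapOn S s ≡ swapOn T s
    swapOn-cong {S} {T} (M , M′) h = cong₂ _,_ (Mat-ext (select-cong M′ M)) (Mat-ext (select-cong M M′))
      where
      select-cong : ∀ A B i j → entry (select S A B) i j ≡ entry (select T A B) i j
      select-cong A B i j rewrite entry-select S A B i j | entry-select T A B i j | h i = refl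

    Matching-select : ∀ S A B → Matching A → Matching B →
                      (∀ i j → S i ≡ true → S j ≡ false → entry A i j ≡ false × entry B i j ≡ false) →
                      Matching (select S A B)
    Matching-select S A B (symA , edgeA , disjA) (symB , edgeB , disjB) cross = symm , edge , disj
      where
      symm : ∀ i j → entry (select S A B) i j ≡ entry (select S A B) j i
      symm i j rewrite entry-select S A B i j | entry-select S A B j i with S i in eᵢ | S j in eⱼ
      ... | true  | true  = symA i j
      ... | false | false = symB i j
      ... | true  | false = trans (proj₁ (cross i j eᵢ eⱼ)) (sym (trans (symB j i) (proj₂ (cross i j eᵢ eⱼ))))
      ... | false | true  = trans (trans (symB i j) (proj₂ (cross j i eⱼ eᵢ))) (sym (proj₁ (cross j i eⱼ eᵢ)))
      edge : ∀ i j → entry (select S A B) i j ≡ true → adj i j ≡ true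
      edge i j rewrite entry-select S A B i j with S i
      ... | true  = edgeA i j
      ... | false = edgeB i j
      disj : ∀ i j j′ → entry (select S A B) i j ≡ true → entry (select S A B) i j′ ≡ true → j ≡ j′
      disj i j j′ rewrite entry-select S A B i j | entry-select S A B i j′ with S i
      ... | true  = disjA i j j′
      ... | false = disjB i j j′

    MatchingPair-swapOn : ∀ S s → MatchingPair s → Closed s S → MatchingPair (swapOn S s)
    MatchingPair-swapOn S (M , M′) (mM , mM′) closed =
      Matching-select S M′ M mM′ mM (λ i j Si Sj → swap× (leaves i j Si Sj)) ,
      Matching-select S M M′ mM mM′ leaves
      where
      leaves : ∀ i j → S i ≡ true → S j ≡ false → entry M i j ≡ false × entry M′ i j ≡ false
      leaves i j Si Sj = ≢true (λ e → true≢false (trans (sym (closed i j Si (∨-introˡ e))) Sj))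
                       , ≢true (λ e → true≢false (trans (sym (closed i j Si (∨-introʳ e))) Sj))
      swap× : ∀ {A B : Set} → A × B → B × A
      swap× (a , b) = b , a

    coverCount : Mat n → ℕ
    coverCount M = count (λ x → anyᵇ (entry M x))

    edgeCount≡∑ℕ : ∀ M → edgeCount {n} M ≡ ∑ℕ (λ i → ∑ℕ (λ j → toℕᵇ ((toℕ i <ᵇ toℕ j) ∧ entry M i j)))
    edgeCount≡∑ℕ M = trans (listSum _) (∑ℕ-cong λ i → trans (listSum _) (∑ℕ-cong λ j → if01 ((toℕ i <ᵇ toℕ j) ∧ entry M i j)))
      where
      open import Data.Nat.ListAction using (sum)
      open import Data.List as List using (map; allFin)
      open import Data.List.Properties using (map-tabulate)
      sum-tabulate : ∀ {m} (g : Fin m → ℕ) → sum (List.tabulate g) ≡ ∑ℕ g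
      sum-tabulate {zero}  g = refl
      sum-tabulate {suc m} g = cong (g zero +_) (sum-tabulate (g ∘ suc))
      listSum : ∀ (f : Fin n → ℕ) → sum (map f (allFin n)) ≡ ∑ℕ f
      listSum f = trans (cong sum (map-tabulate id f)) (sum-tabulate f)
      if01 : ∀ b → (if b then 1 else 0) ≡ toℕᵇ b
      if01 true  = refl
      if01 false = refl

    -- Each edge {i,j} of M is counted once at i and once at j.
    edgeCount-double : ∀ M → Matching M → 2 * edgeCount {n} M ≡ coverCount M
    edgeCount-double M mM@(symM , _ , disjM) = begin
        2 * edgeCount {n} M                         ≡⟨ cong (2 *_) (edgeCount≡∑ℕ M) ⟩
        E + (E + 0)                                 ≡⟨ cong (E +_) (+-identityʳ E) ⟩
        E + E                                       ≡⟨ cong (E +_) (∑ℕ-comm f) ⟩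
        E + ∑ℕ (λ i → ∑ℕ (λ j → f j i))             ≡⟨ sym (∑ℕ-distrib-+ (∑ℕ ∘ f) (λ i → ∑ℕ (λ j → f j i))) ⟩
        ∑ℕ (λ i → ∑ℕ (f i) + ∑ℕ (λ j → f j i))      ≡⟨ ∑ℕ-cong (λ i → sym (∑ℕ-distrib-+ (f i) (λ j → f j i))) ⟩
        ∑ℕ (λ i → ∑ℕ (λ j → f i j + f j i))         ≡⟨ ∑ℕ-cong (λ i → ∑ℕ-cong (f-sym i)) ⟩
        ∑ℕ (λ i → count (entry M i))                ≡⟨ ∑ℕ-cong (λ i → count-unique (entry M i) (disjM i)) ⟩
        coverCount M                                ∎
      where
      open ≡-Reasoning
      f : Fin n → Fin n → ℕ
      f i j = toℕᵇ ((toℕ i <ᵇ toℕ j) ∧ entry M i j)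
      E : ℕ
      E = ∑ℕ (λ i → ∑ℕ (f i))
      f-sym : ∀ i j → f i j + f j i ≡ toℕᵇ (entry M i j)
      f-sym i j rewrite symM j i with toℕ i <ᵇ toℕ j | <ᵇ-reflects-< (toℕ i) (toℕ j)
                                    | toℕ j <ᵇ toℕ i | <ᵇ-reflects-< (toℕ j) (toℕ i)
      ... | true  | ofʸ i<j | true  | ofʸ j<i = ⊥-elim (<-asym i<j j<i)
      ... | true  | _       | false | _       = +-identityʳ _
      ... | false | _       | true  | _       = refl
      ... | false | ofⁿ i≮j | false | ofⁿ j≮i =
        cong toℕᵇ (sym (trans (cong (λ z → entry M z j) (toℕ-injective (≤-antisym (≮⇒≥ j≮i) (≮⇒≥ i≮j))))
                              (Matching-irrefl {M} mM j)))

    -- Alternating walks from a leaf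

    side : Bool → Pair → Mat n
    side true  (M , _)  = M
    side false (_ , M′) = M′

    Matching-side : ∀ {s} → MatchingPair s → ∀ t → Matching (side t s)
    Matching-side (mM , _)  true  = mM
    Matching-side (_ , mM′) false = mM′

    partner : Pair → Bool → Fin n → Maybe (Fin n)
    partner s t x = first (entry (side t s) x)

    module AlternatingWalk (s : Pair) (ms : MatchingPair s) (v : Fin n) (t₀ : Bool)
                           (v-end : partner s (not t₀) v ≡ nothing) where

      open import Data.Nat.Induction using (<-rec)
      open import Data.Maybe.Properties using (just-injective)

      partner-entry : ∀ t x {y} → partner s t x ≡ just y → entry (side t s) x y ≡ true
      partner-entry t x = first-just (entry (side t s) x)

      entry-partner : ∀ t x {y} → entry (side t s) x y ≡ true → partner s t x ≡ just y
      entry-partner t x = first-unique (entry (side t s) x) (proj₂ (proj₂ (Matching-side ms t)) x) _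

      partner-sym : ∀ t x {y} → partner s t x ≡ just y → partner s t y ≡ just x
      partner-sym t x {y} e = entry-partner t y (trans (proj₁ (Matching-side ms t) y x) (partner-entry t x e))

      partner-irrefl : ∀ t x → partner s t x ≢ just x
      partner-irrefl t x e = true≢false (trans (sym (partner-entry t x e)) (Matching-irrefl {side t s} (Matching-side ms t) x))

      partner-functional : ∀ t x {y z} → partner s t x ≡ just y → partner s t x ≡ just z → y ≡ z
      partner-functional _ _ e₁ e₂ = just-injective (trans (sym e₁) e₂)

      step : Maybe (Fin n × Bool) → Maybe (Fin n × Bool)
      step nothing        = nothing
      step (just (x , t)) = Maybe.map (_, not t) (partner s t x)

      -- walk i is the i-th vertex of the walk together with the side of the edge leaving it.
      walk : ℕ → Maybe (Fin n × Bool)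
      walk zero    = just (v , t₀)
      walk (suc i) = step (walk i)

      just-injective₂ : ∀ {a b : Bool} {x y : Fin n} → just (x , a) ≡ just (y , b) → x ≡ y × a ≡ b
      just-injective₂ refl = refl , refl

      walk-next : ∀ i {x t y} → walk i ≡ just (x , t) → partner s t x ≡ just y → walk (suc i) ≡ just (y , not t)
      walk-next i wᵢ p rewrite wᵢ | p = refl

      walk-prev : ∀ i {y t} → walk (suc i) ≡ just (y , t) →
                  ∃ λ x → walk i ≡ just (x , not t) × partner s (not t) x ≡ just y
      walk-prev i e with walk i
      ... | just (x , t′) with partner s t′ x in p
      walk-prev i {y} refl | just (x , t′) | just .y rewrite not-involutive t′ = x , refl , p

      walk-arrival : ∀ i {y t} → walk (suc i) ≡ just (y , t) →
                     ∃ λ x → walk i ≡ just (x , not t) × partner s (not t) y ≡ just x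
      walk-arrival i {t = t} w with walk-prev i w
      ... | x , wᵢ , p = x , wᵢ , partner-sym (not t) x p

      walk-stopped : ∀ {i j} → i ≤ j → walk i ≡ nothing → walk j ≡ nothing
      walk-stopped {i} {j} i≤j e with ≤⇒≤′ i≤j
      ... | ℕ.≤′-refl = e
      ... | ℕ.≤′-step {j₁} i≤′j₁ rewrite walk-stopped (≤′⇒≤ i≤′j₁) e = refl

      NoRepeatAt : ℕ → Set
      NoRepeatAt j = ∀ {i x t t′} → i < j → walk i ≡ just (x , t) → walk j ≡ just (x , t′) → ⊥

      -- A first repetition walk i = walk j would force an earlier one, through the predecessor
      -- of j and either the predecessor or the successor of i.
      walk-no-repeat : ∀ j → NoRepeatAt j
      walk-no-repeat = <-rec NoRepeatAt no-repeat-step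
        where
        no-repeat-step : ∀ j → (∀ {j′} → j′ < j → NoRepeatAt j′) → NoRepeatAt j
        no-repeat-step (suc j₁) earlier {i} {x} {t} {t′} i<j wᵢ wⱼ with walk-arrival j₁ wⱼ
        ... | y , wⱼ₁ , p with i ℕ.≟ j₁
        ... | yes refl = partner-irrefl (not t′) x (trans p (cong just (sym (proj₁ (just-injective₂ (trans (sym wᵢ) wⱼ₁))))))
        ... | no i≢j₁ = before i (≤∧≢⇒< (≤-pred i<j) i≢j₁) wᵢ
          where
          before : ∀ i → i < j₁ → walk i ≡ just (x , t) → ⊥
          before zero i<j₁ w₀ with just-injective₂ w₀
          ... | refl , refl with not t′ Bool.≟ t₀
          ... | no ≢t₀ = case-nothing (trans (sym v-end) (trans (cong (λ b → partner s b x) (sym (¬-not ≢t₀))) p))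
            where
            case-nothing : nothing ≢ just y
            case-nothing ()
          ... | yes ≡t₀ with walk-next 0 refl (subst (λ b → partner s b x ≡ just y) ≡t₀ p)
          ... | w₁ with j₁ ℕ.≟ 1
          ... | yes refl = not-¬ {t₀} refl (trans (sym ≡t₀) (sym (proj₂ (just-injective₂ (trans (sym w₁) wⱼ₁)))))
          ... | no j₁≢1 = earlier ≤-refl (≤∧≢⇒< i<j₁ (j₁≢1 ∘ sym)) w₁ wⱼ₁
          before (suc i₁) i<j₁ wᵢ′ with walk-arrival i₁ wᵢ′
          ... | z , wᵢ₁ , q with t′ Bool.≟ t
          ... | yes refl = earlier ≤-refl (≤-trans (n≤1+n (suc i₁)) i<j₁)
                             (subst (λ u → walk i₁ ≡ just (u , not t)) (partner-functional (not t) x q p) wᵢ₁) wⱼ₁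
          ... | no t′≢t with walk-next (suc i₁) wᵢ′ (subst (λ b → partner s b x ≡ just y) not-t′≡t p)
            where
            not-t′≡t : not t′ ≡ t
            not-t′≡t = trans (cong not (¬-not t′≢t)) (not-involutive t)
          ... | wᵢ₊₁ with suc (suc i₁) ℕ.≟ j₁
          ... | yes refl = t′≢t (sym (not-injective (proj₂ (just-injective₂ (trans (sym wᵢ₊₁) wⱼ₁)))))
          ... | no i₊₁≢j₁ = earlier ≤-refl (≤∧≢⇒< i<j₁ i₊₁≢j₁) wᵢ₊₁ wⱼ₁

      walk-defined : ∀ {i j w} → i ≤ j → walk j ≡ just w → ∃ λ x → ∃ λ t → walk i ≡ just (x , t)
      walk-defined {i} i≤j wⱼ with walk i in wᵢ
      ... | just (x , t) = x , t , refl
      ... | nothing with trans (sym wⱼ) (walk-stopped i≤j wᵢ)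
      ... | ()

      walk-terminates : walk n ≡ nothing
      walk-terminates with walk n in wₙ
      ... | nothing = refl
      ... | just w with pigeonhole (n<1+n n) (vertexAt ∘ walk ∘ toℕ)
        where
        vertexAt : Maybe (Fin n × Bool) → Fin n
        vertexAt nothing        = v
        vertexAt (just (x , _)) = x
      ... | i , j , i<j , same
        with walk-defined (≤-pred (toℕ<n i)) wₙ | walk-defined (≤-pred (toℕ<n j)) wₙ
      ... | x , _ , wᵢ | y , _ , wⱼ rewrite wᵢ | wⱼ | same = ⊥-elim (walk-no-repeat (toℕ j) i<j wᵢ wⱼ)

      walk-bounded : ∀ i {x t} → walk i ≡ just (x , t) → i < n
      walk-bounded i wᵢ with i <? n
      ... | yes i<n = i<n
      ... | no i≮n with trans (sym wᵢ) (walk-stopped (≮⇒≥ i≮n) walk-terminates)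
      ... | ()

      visits : Fin n → Maybe (Fin n × Bool) → Bool
      visits x nothing        = false
      visits x (just (y , _)) = y == x

      onWalk : Fin n → Bool
      onWalk x = anyᵇ (λ (i : Fin n) → visits x (walk (toℕ i)))

      onWalk-intro : ∀ i {x t} → walk i ≡ just (x , t) → onWalk x ≡ true
      onWalk-intro i {x} wᵢ = anyᵇ-intro (λ (j : Fin n) → visits x (walk (toℕ j))) (fromℕ< i<n)
        (subst (λ w → visits x w ≡ true) (sym (trans (cong walk (toℕ-fromℕ< i<n)) wᵢ)) (==-refl x))
        where
        i<n : i < n
        i<n = walk-bounded i wᵢ

      onWalk-elim : ∀ x → onWalk x ≡ true → ∃ λ i → ∃ λ t → walk i ≡ just (x , t)
      onWalk-elim x e with anyᵇ-witness (λ (i : Fin n) → visits x (walk (toℕ i))) e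
      ... | i , q with walk (toℕ i) in wᵢ
      ... | just (y , t) = toℕ i , t , trans wᵢ (cong (λ z → just (z , t)) (==-sound q))

      onWalk-start : onWalk v ≡ true
      onWalk-start = onWalk-intro 0 refl

      onWalk-partner : ∀ i {x tᵢ} t {y} → walk i ≡ just (x , tᵢ) → partner s t x ≡ just y → onWalk y ≡ true
      onWalk-partner i {x} {tᵢ} t wᵢ p with t Bool.≟ tᵢ
      ... | yes refl = onWalk-intro (suc i) (walk-next i wᵢ p)
      onWalk-partner zero {x} {tᵢ} t {y} wᵢ p | no t≢tᵢ with just-injective₂ wᵢ
      ... | refl , refl = ⊥-elim (case-nothing (trans (sym v-end) (subst (λ b → partner s b x ≡ just y) (¬-not t≢tᵢ) p)))
        where
        case-nothing : nothing ≢ just y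
        case-nothing ()
      onWalk-partner (suc i₁) {x} {tᵢ} t {y} wᵢ p | no t≢tᵢ with walk-arrival i₁ wᵢ
      ... | z , wᵢ₁ , q = onWalk-intro i₁
        (subst (λ u → walk i₁ ≡ just (u , not tᵢ))
               (partner-functional (not tᵢ) x q (subst (λ b → partner s b x ≡ just y) (¬-not t≢tᵢ) p)) wᵢ₁)

      onWalk-closed : Closed s onWalk
      onWalk-closed x y onx a with onWalk-elim x onx
      ... | i , tᵢ , wᵢ with ∨-elim a
      ... | inj₁ e = onWalk-partner i true  wᵢ (entry-partner true  x e)
      ... | inj₂ e = onWalk-partner i false wᵢ (entry-partner false x e)

      covered-partner : ∀ t x {y} → partner s t x ≡ just y → anyᵇ (entry (side t s) x) ≡ true
      covered-partner t x p = anyᵇ-intro (entry (side t s) x) _ (partner-entry t x p)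

      leaf-no-partners : ∀ t x {y z} → partner s t x ≡ just y → partner s (not t) x ≡ just z → leaf s x ≡ false
      leaf-no-partners true  x p q rewrite covered-partner true x p | covered-partner false x q = refl
      leaf-no-partners false x p q rewrite covered-partner false x p | covered-partner true x q = refl

      walk-stops-at-leaf : ∀ i {x t} → walk (suc i) ≡ just (x , t) → leaf s x ≡ true → walk (suc (suc i)) ≡ nothing
      walk-stops-at-leaf i {x} w lf with walk (suc (suc i)) in e
      ... | nothing = refl
      ... | just (y , t″) with walk-prev (suc i) e | walk-arrival i w
      ... | x′ , wx′ , p | z , _ , q with just-injective₂ (trans (sym w) wx′)
      ... | refl , refl = ⊥-elim (true≢false (trans (sym lf) (leaf-no-partners (not t″) x p q)))

      laterLeaf : Fin n → Bool
      laterLeaf x = (onWalk x ∧ leaf s x) ∧ not (v == x)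

      laterLeaf⇒leaf : ∀ {x} → laterLeaf x ≡ true → leaf s x ≡ true
      laterLeaf⇒leaf {x} e = ∧-elimʳ {onWalk x} (∧-elimˡ {onWalk x ∧ leaf s x} e)

      laterLeaf-position : ∀ x → laterLeaf x ≡ true → ∃ λ i → ∃ λ t → walk (suc i) ≡ just (x , t)
      laterLeaf-position x e with onWalk-elim x (∧-elimˡ (∧-elimˡ e))
      ... | zero , t , w with just-injective₂ w
      ...   | refl , _ = ⊥-elim (true≢false (trans (sym (∧-elimʳ e)) (cong not (==-refl v))))
      laterLeaf-position x e | suc i , t , w = i , t , w

      -- Beyond the start, a leaf can only be the last vertex of the walk.
      laterLeaf-unique : ∀ x x′ → laterLeaf x ≡ true → laterLeaf x′ ≡ true → x ≡ x′
      laterLeaf-unique x x′ e e′ with laterLeaf-position x e | laterLeaf-position x′ e′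
      ... | i , t , w | i′ , t′ , w′ with <-cmp i i′
      ... | tri≈ _ refl _ = proj₁ (just-injective₂ (trans (sym w) w′))
      ... | tri< i<i′ _ _ with trans (sym w′) (walk-stopped (s≤s i<i′) (walk-stops-at-leaf i w (laterLeaf⇒leaf e)))
      ...   | ()
      laterLeaf-unique x x′ e e′ | i , t , w | i′ , t′ , w′ | tri> _ _ i′<i
        with trans (sym w) (walk-stopped (s≤s i′<i) (walk-stops-at-leaf i′ w′ (laterLeaf⇒leaf e′)))
      ...   | ()

      onWalk-leaves≤2 : count (λ x → onWalk x ∧ leaf s x) ≤ 2
      onWalk-leaves≤2 = begin
        count (λ x → onWalk x ∧ leaf s x)   ≤⟨ ∑ℕ-mono-≤ split ⟩
        ∑ℕ (λ x → toℕᵇ (v == x) + toℕᵇ (laterLeaf x))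
                                            ≡⟨ ∑ℕ-distrib-+ (toℕᵇ ∘ (v ==_)) (toℕᵇ ∘ laterLeaf) ⟩
        count (v ==_) + count laterLeaf     ≡⟨ cong₂ _+_ (count-== v) (count-unique laterLeaf laterLeaf-unique) ⟩
        1 + toℕᵇ (anyᵇ laterLeaf)           ≤⟨ +-monoʳ-≤ 1 (toℕᵇ≤1 _) ⟩
        2                                   ∎
        where
        open ≤-Reasoning
        split : ∀ x → toℕᵇ (onWalk x ∧ leaf s x) ≤ toℕᵇ (v == x) + toℕᵇ (laterLeaf x)
        split x with v == x
        ... | true  = ≤-trans (toℕᵇ≤1 _) (s≤s z≤n)
        ... | false rewrite ∧-identityʳ (onWalk x ∧ leaf s x) = ≤-refl

      component-leaves≤2 : count (component s v ∩ leaf s) ≤ 2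
      component-leaves≤2 = ≤-trans (count-mono inWalk) onWalk-leaves≤2
        where
        inWalk : ∀ x → component s v x ∧ leaf s x ≡ true → onWalk x ∧ leaf s x ≡ true
        inWalk x e = ∧-intro (component-minimal s onWalk v onWalk-closed onWalk-start x (∧-elimˡ e)) (∧-elimʳ e)

    component-leaves≤2 : ∀ s → MatchingPair s → ∀ v → leaf s v ≡ true → count (component s v ∩ leaf s) ≤ 2
    component-leaves≤2 s ms v lv with coveredˡ s v in eˡ | coveredʳ s v in eʳ
    ... | true  | false = AlternatingWalk.component-leaves≤2 s ms v true  (first-nothing _ eʳ)
    ... | false | true  = AlternatingWalk.component-leaves≤2 s ms v false (first-nothing _ eˡ)
    component-leaves≤2 s ms v () | true  | true
    component-leaves≤2 s ms v () | false | false

    module _ (S : Fin n → Bool) (s : Pair) where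

      private
        if-∧ : ∀ a b c → toℕᵇ (if a then c else b) + toℕᵇ (a ∧ b) ≡ toℕᵇ b + toℕᵇ (a ∧ c)
        if-∧ true  b c = +-comm (toℕᵇ c) (toℕᵇ b)
        if-∧ false b c = refl

      coverCountˡ-swapOn : coverCount (proj₁ (swapOn S s)) + count (S ∩ coveredˡ s) ≡ coverCount (proj₁ s) + count (S ∩ coveredʳ s)
      coverCountˡ-swapOn = ∑ℕ-pointwise λ x →
        trans (cong (λ z → toℕᵇ z + toℕᵇ (S x ∧ coveredˡ s x)) (anyᵇ-select S (proj₂ s) (proj₁ s) x))
              (if-∧ (S x) (coveredˡ s x) (coveredʳ s x))

      coverCountʳ-swapOn : coverCount (proj₂ (swapOn S s)) + count (S ∩ coveredʳ s) ≡ coverCount (proj₂ s) + count (S ∩ coveredˡ s)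
      coverCountʳ-swapOn = ∑ℕ-pointwise λ x →
        trans (cong (λ z → toℕᵇ z + toℕᵇ (S x ∧ coveredʳ s x)) (anyᵇ-select S (proj₁ s) (proj₂ s) x))
              (if-∧ (S x) (coveredʳ s x) (coveredˡ s x))

      covered-only : count (S ∩ coveredˡ s) + count (S ∩ onlyʳ s) ≡ count (S ∩ coveredʳ s) + count (S ∩ onlyˡ s)
      covered-only = ∑ℕ-pointwise λ x → pointwise (S x) (coveredˡ s x) (coveredʳ s x)
        where
        pointwise : ∀ a b c → toℕᵇ (a ∧ b) + toℕᵇ (a ∧ (c ∧ not b)) ≡ toℕᵇ (a ∧ c) + toℕᵇ (a ∧ (b ∧ not c))
        pointwise false _     _     = refl
        pointwise true  true  true  = refl
        pointwise true  true  false = refl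
        pointwise true  false true  = refl
        pointwise true  false false = refl

      count-leaf : count (S ∩ leaf s) ≡ count (S ∩ onlyˡ s) + count (S ∩ onlyʳ s)
      count-leaf = trans (∑ℕ-cong λ x → pointwise (S x) (coveredˡ s x) (coveredʳ s x))
                         (∑ℕ-distrib-+ (toℕᵇ ∘ (S ∩ onlyˡ s)) (toℕᵇ ∘ (S ∩ onlyʳ s)))
        where
        pointwise : ∀ a b c → toℕᵇ (a ∧ ((b ∧ not c) ∨ (c ∧ not b))) ≡ toℕᵇ (a ∧ (b ∧ not c)) + toℕᵇ (a ∧ (c ∧ not b))
        pointwise false _     _     = refl
        pointwise true  true  true  = refl
        pointwise true  true  false = refl
        pointwise true  false true  = refl
        pointwise true  false false = refl

    -- pathEndˡ s v: v is an end of a path component of M ∪ M′ whose two end edges lie in M.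
    noOnlyˡ noOnlyʳ pathEndˡ pathEndʳ : Pair → Fin n → Bool
    noOnlyˡ s v = not (anyᵇ (component s v ∩ onlyˡ s))
    noOnlyʳ s v = not (anyᵇ (component s v ∩ onlyʳ s))
    pathEndˡ s v = onlyˡ s v ∧ noOnlyʳ s v
    pathEndʳ s v = onlyʳ s v ∧ noOnlyˡ s v

    flipAt : Pair → Fin n → Pair
    flipAt s v = swapOn (component s v) s

    joined-swap : ∀ s x y → joined (swap s) x y ≡ joined s x y
    joined-swap (M , M′) x y = ∨-comm (entry M′ x y) (entry M x y)

    component-swap : ∀ s v x → component (swap s) v x ≡ component s v x
    component-swap s = component-cong (joined-swap s)

    pathEndˡ-swap : ∀ s v → pathEndˡ (swap s) v ≡ pathEndʳ s v
    pathEndˡ-swap s v = cong (λ z → onlyʳ s v ∧ not z) (anyᵇ-cong λ x → cong (_∧ onlyˡ s x) (component-swap s v x))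

    flipAt-swap : ∀ s v → flipAt (swap s) v ≡ swap (flipAt s v)
    flipAt-swap (M , M′) v = swapOn-cong (M′ , M) (component-swap (M , M′) v)

    module FlipLeftPath (s : Pair) (ms : MatchingPair s) (v : Fin n) (end : pathEndˡ s v ≡ true) where

      private
        S : Fin n → Bool
        S = component s v
        N N′ : Mat n
        N = proj₁ (flipAt s v)
        N′ = proj₂ (flipAt s v)
        α β γ : ℕ
        α = count (S ∩ onlyˡ s)
        β = count (S ∩ onlyʳ s)
        γ = count (S ∩ coveredʳ s)

        v-onlyˡ : onlyˡ s v ≡ true
        v-onlyˡ = ∧-elimˡ {onlyˡ s v} end

        β≡0 : β ≡ 0
        β≡0 = count-none (S ∩ onlyʳ s) (anyᵇ-false _ (not-true (∧-elimʳ {onlyˡ s v} end)))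

        1≤α : 1 ≤ α
        1≤α = count-pos (S ∩ onlyˡ s) v (∧-intro (component-refl s v) v-onlyˡ)

        α≤2 : α ≤ 2
        α≤2 = begin
          α      ≡⟨ sym (+-identityʳ α) ⟩
          α + 0  ≡⟨ cong (α +_) (sym β≡0) ⟩
          α + β  ≡⟨ sym (count-leaf S s) ⟩
          count (S ∩ leaf s) ≤⟨ component-leaves≤2 s ms v (∨-introˡ v-onlyˡ) ⟩
          2      ∎
          where open ≤-Reasoning

        coveredˡ≡ : count (S ∩ coveredˡ s) ≡ γ + α
        coveredˡ≡ = begin
          count (S ∩ coveredˡ s)      ≡⟨ sym (+-identityʳ _) ⟩
          count (S ∩ coveredˡ s) + 0  ≡⟨ cong (count (S ∩ coveredˡ s) +_) (sym β≡0) ⟩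
          count (S ∩ coveredˡ s) + β  ≡⟨ covered-only S s ⟩
          γ + α                       ∎
          where open ≡-Reasoning

        coverCountˡ : coverCount N + α ≡ coverCount (proj₁ s)
        coverCountˡ = +-cancelʳ-≡ γ _ _ (begin
          coverCount N + α + γ            ≡⟨ +-assoc (coverCount N) α γ ⟩
          coverCount N + (α + γ)          ≡⟨ cong (coverCount N +_) (trans (+-comm α γ) (sym coveredˡ≡)) ⟩
          coverCount N + count (S ∩ coveredˡ s) ≡⟨ coverCountˡ-swapOn S s ⟩
          coverCount (proj₁ s) + γ        ∎)
          where open ≡-Reasoning

        coverCountʳ : coverCount N′ ≡ coverCount (proj₂ s) + α
        coverCountʳ = +-cancelʳ-≡ γ _ _ (begin
          coverCount N′ + γ                      ≡⟨ coverCountʳ-swapOn S s ⟩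
          coverCount (proj₂ s) + count (S ∩ coveredˡ s) ≡⟨ cong (coverCount (proj₂ s) +_) (trans coveredˡ≡ (+-comm γ α)) ⟩
          coverCount (proj₂ s) + (α + γ)         ≡⟨ sym (+-assoc (coverCount (proj₂ s)) α γ) ⟩
          coverCount (proj₂ s) + α + γ           ∎)
          where open ≡-Reasoning

      MatchingPair-flip : MatchingPair (flipAt s v)
      MatchingPair-flip = MatchingPair-swapOn S s ms (component-closed s v)

      -- The component of v has one or two vertices covered by M only; flipping lowers coverCount M
      -- by that number, and one is ruled out since coverCount of a matching is even.
      onlyˡ-count≡2 : α ≡ 2
      onlyˡ-count≡2 with α | 1≤α | α≤2 | coverCountˡ
      ... | 1 | _ | _ | e = ⊥-elim (even≢odd (edgeCount {n} (proj₁ s)) (edgeCount {n} N)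
            (trans (edgeCount-double (proj₁ s) (proj₁ ms)) (trans (sym e)
                   (trans (+-comm (coverCount N) 1) (cong suc (sym (edgeCount-double N (proj₁ MatchingPair-flip))))))))
      ... | 2 | _ | _ | _ = refl
      ... | suc (suc (suc _)) | _ | s≤s (s≤s ()) | _

      edgeCountˡ-flip : edgeCount {n} N + 1 ≡ edgeCount {n} (proj₁ s)
      edgeCountˡ-flip = *-cancelˡ-≡ _ _ 2 (begin
        2 * (edgeCount {n} N + 1)       ≡⟨ *-distribˡ-+ 2 (edgeCount {n} N) 1 ⟩
        2 * edgeCount {n} N + 2         ≡⟨ cong (_+ 2) (edgeCount-double N (proj₁ MatchingPair-flip)) ⟩
        coverCount N + 2                ≡⟨ cong (coverCount N +_) (sym onlyˡ-count≡2) ⟩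
        coverCount N + α                ≡⟨ coverCountˡ ⟩
        coverCount (proj₁ s)            ≡⟨ sym (edgeCount-double (proj₁ s) (proj₁ ms)) ⟩
        2 * edgeCount {n} (proj₁ s)     ∎)
        where open ≡-Reasoning

      edgeCountʳ-flip : edgeCount {n} N′ ≡ edgeCount {n} (proj₂ s) + 1
      edgeCountʳ-flip = *-cancelˡ-≡ _ _ 2 (begin
        2 * edgeCount {n} N′            ≡⟨ edgeCount-double N′ (proj₂ MatchingPair-flip) ⟩
        coverCount N′                   ≡⟨ coverCountʳ ⟩
        coverCount (proj₂ s) + α        ≡⟨ cong (coverCount (proj₂ s) +_) onlyˡ-count≡2 ⟩
        coverCount (proj₂ s) + 2        ≡⟨ cong (_+ 2) (sym (edgeCount-double (proj₂ s) (proj₂ ms))) ⟩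
        2 * edgeCount {n} (proj₂ s) + 2 ≡⟨ sym (*-distribˡ-+ 2 (edgeCount {n} (proj₂ s)) 1) ⟩
        2 * (edgeCount {n} (proj₂ s) + 1) ∎)
        where open ≡-Reasoning

    module FlipRightPath (s : Pair) (ms : MatchingPair s) (v : Fin n) (end : pathEndʳ s v ≡ true) where

      private
        module L = FlipLeftPath (swap s) (swap ms) v (trans (pathEndˡ-swap s v) end)

      MatchingPair-flip : MatchingPair (flipAt s v)
      MatchingPair-flip = swap (subst MatchingPair (flipAt-swap s v) L.MatchingPair-flip)

      onlyʳ-count≡2 : count (component s v ∩ onlyʳ s) ≡ 2
      onlyʳ-count≡2 = trans (count-cong λ x → cong (_∧ onlyʳ s x) (sym (component-swap s v x))) L.onlyˡ-count≡2

      edgeCountʳ-flip : edgeCount {n} (proj₂ (flipAt s v)) + 1 ≡ edgeCount {n} (proj₂ s)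
      edgeCountʳ-flip = subst (λ M → edgeCount {n} M + 1 ≡ edgeCount {n} (proj₂ s)) (cong proj₁ (flipAt-swap s v)) L.edgeCountˡ-flip

      edgeCountˡ-flip : edgeCount {n} (proj₁ (flipAt s v)) ≡ edgeCount {n} (proj₁ s) + 1
      edgeCountˡ-flip = subst (λ M → edgeCount {n} M ≡ edgeCount {n} (proj₁ s) + 1) (cong proj₂ (flipAt-swap s v)) L.edgeCountʳ-flip

    module PermutationAction (σ : Permutation′ n) where

      private
        τ : Fin n → Fin n
        τ = σ ⟨$⟩ʳ_

        τ-injective : ∀ {a b} → τ a ≡ τ b → a ≡ b
        τ-injective e = trans (sym (inverseˡ σ)) (trans (cong (σ ⟨$⟩ˡ_) e) (inverseˡ σ))

      actPair : Pair → Pair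
      actPair (M , M′) = actInv σ M , actInv σ M′

      entry-actInv : ∀ M i j → entry (actInv σ M) i j ≡ entry M (τ i) (τ j)
      entry-actInv M = entry-fromEntries (λ i j → entry M (τ i) (τ j))

      ==-act : ∀ a b → τ a == τ b ≡ a == b
      ==-act a b = ≡-by-⇔ (λ e → subst (λ z → a == z ≡ true) (τ-injective (==-sound e)) (==-refl a))
                          (λ e → subst (λ z → τ a == τ z ≡ true) (==-sound e) (==-refl (τ a)))

      joined-act : ∀ s x y → joined (actPair s) x y ≡ joined s (τ x) (τ y)
      joined-act (M , M′) x y = cong₂ _∨_ (entry-actInv M x y) (entry-actInv M′ x y)

      anyᵇ-actInv : ∀ M x → anyᵇ (entry (actInv σ M) x) ≡ anyᵇ (entry M (τ x))
      anyᵇ-actInv M x = trans (anyᵇ-cong (entry-actInv M x)) (anyᵇ-permute σ (entry M (τ x)))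

      onlyˡ-act : ∀ s x → onlyˡ (actPair s) x ≡ onlyˡ s (τ x)
      onlyˡ-act (M , M′) x = cong₂ (λ p q → p ∧ not q) (anyᵇ-actInv M x) (anyᵇ-actInv M′ x)

      onlyʳ-act : ∀ s x → onlyʳ (actPair s) x ≡ onlyʳ s (τ x)
      onlyʳ-act (M , M′) x = cong₂ (λ p q → p ∧ not q) (anyᵇ-actInv M′ x) (anyᵇ-actInv M x)

      component-act : ∀ s v x → component (actPair s) v x ≡ component s (τ v) (τ x)
      component-act s = reach-act n
        where
        reach-act : ∀ k v x → reach (actPair s) k v x ≡ reach s k (τ v) (τ x)
        reach-act zero    v x = sym (==-act v x)
        reach-act (suc k) v x = cong₂ _∨_ (reach-act k v x)
          (trans (anyᵇ-cong (λ y → cong₂ _∧_ (reach-act k v y) (joined-act s y x)))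
                 (anyᵇ-permute σ (λ y → reach s k (τ v) y ∧ joined s y (τ x))))

      pathEndˡ-act : ∀ s v → pathEndˡ (actPair s) v ≡ pathEndˡ s (τ v)
      pathEndˡ-act s v = cong₂ _∧_ (onlyˡ-act s v) (cong not
        (trans (anyᵇ-cong (λ x → cong₂ _∧_ (component-act s v x) (onlyʳ-act s x)))
               (anyᵇ-permute σ (component s (τ v) ∩ onlyʳ s))))

      select-act : ∀ S A B → select (S ∘ τ) (actInv σ A) (actInv σ B) ≡ actInv σ (select S A B)
      select-act S A B = Mat-ext λ i j → begin
        entry (select (S ∘ τ) (actInv σ A) (actInv σ B)) i j
          ≡⟨ entry-select (S ∘ τ) (actInv σ A) (actInv σ B) i j ⟩
        (if S (τ i) then entry (actInv σ A) i j else entry (actInv σ B) i j)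
          ≡⟨ cong₂ (if S (τ i) then_else_) (entry-actInv A i j) (entry-actInv B i j) ⟩
        (if S (τ i) then entry A (τ i) (τ j) else entry B (τ i) (τ j))
          ≡⟨ sym (entry-select S A B (τ i) (τ j)) ⟩
        entry (select S A B) (τ i) (τ j)
          ≡⟨ sym (entry-actInv (select S A B) i j) ⟩
        entry (actInv σ (select S A B)) i j ∎
        where open ≡-Reasoning

      flipAt-act : ∀ s v → flipAt (actPair s) v ≡ actPair (flipAt s (τ v))
      flipAt-act (M , M′) v = trans (swapOn-cong (actPair (M , M′)) (component-act (M , M′) v))
        (cong₂ _,_ (select-act (component (M , M′) (τ v)) M′ M) (select-act (component (M , M′) (τ v)) M M′))

      module _ (aut : IsAut G σ) where

        Matching-actInv : ∀ M → Matching M → Matching (actInv σ M)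
        Matching-actInv M (symM , edgeM , disjM) =
            (λ i j → trans (entry-actInv M i j) (trans (symM (τ i) (τ j)) (sym (entry-actInv M j i))))
          , (λ i j e → trans (sym (aut i j)) (edgeM (τ i) (τ j) (trans (sym (entry-actInv M i j)) e)))
          , (λ i j j′ e e′ → τ-injective (disjM (τ i) (τ j) (τ j′) (trans (sym (entry-actInv M i j)) e)
                                                                 (trans (sym (entry-actInv M i j′)) e′)))

        Matching-actInv⁻ : ∀ M → Matching (actInv σ M) → Matching M
        Matching-actInv⁻ M (symσ , edgeσ , disjσ) = symM , edgeM , disjM
          where
          ι : Fin n → Fin n
          ι = σ ⟨$⟩ˡ_
          back : ∀ i j → entry M i j ≡ entry (actInv σ M) (ι i) (ι j)
          back i j = sym (trans (entry-actInv M (ι i) (ι j)) (cong₂ (entry M) (inverseʳ σ) (inverseʳ σ)))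
          symM : ∀ i j → entry M i j ≡ entry M j i
          symM i j = trans (back i j) (trans (symσ (ι i) (ι j)) (sym (back j i)))
          edgeM : ∀ i j → entry M i j ≡ true → adj i j ≡ true
          edgeM i j e = trans (cong₂ adj (sym (inverseʳ σ)) (sym (inverseʳ σ)))
                              (trans (aut (ι i) (ι j)) (edgeσ (ι i) (ι j) (trans (sym (back i j)) e)))
          disjM : ∀ i j j′ → entry M i j ≡ true → entry M i j′ ≡ true → j ≡ j′
          disjM i j j′ e e′ = trans (sym (inverseʳ σ))
            (trans (cong τ (disjσ (ι i) (ι j) (ι j′) (trans (sym (back i j)) e) (trans (sym (back i j′)) e′))) (inverseʳ σ))

        isMatchingPair-act : ∀ s → isMatchingPair (actPair s) ≡ isMatchingPair s
        isMatchingPair-act (M , M′) with matchingPair? (M , M′)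
        ... | yes (mM , mM′) = isMatchingPair-true {actPair (M , M′)} (Matching-actInv M mM , Matching-actInv M′ mM′)
        ... | no ¬ms = isMatchingPair-false {actPair (M , M′)} λ (mM , mM′) → ¬ms (Matching-actInv⁻ M mM , Matching-actInv⁻ M′ mM′)

    module FlipComponent (s : Pair) (ms : MatchingPair s) (v : Fin n) where

      private
        S : Fin n → Bool
        S = component s v
        s′ : Pair
        s′ = flipAt s v

        ∧-if : ∀ b (a c : Bool) → b ∧ (if b then a else c) ≡ b ∧ a
        ∧-if true  a c = refl
        ∧-if false a c = refl

        outside : ∀ u → S u ≡ false → ∀ x → component s u x ≡ true → S x ≡ false
        outside u e x ux = component-disjoint s ms u v (≢true λ e′ → true≢false (trans (sym (component-sym s ms u v e′)) e)) x ux

        inside : ∀ u → S u ≡ true → ∀ x → component s u x ≡ S x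
        inside u e = component-same s ms v u e

        no-only : ∀ (only only′ : Pair → Fin n → Bool) → (∀ x → only (flipAt s v) x ≡ (if S x then only′ s x else only s x)) →
                  ∀ u → not (anyᵇ (component s′ u ∩ only s′))
                      ≡ (if S u then not (anyᵇ (component s u ∩ only′ s)) else not (anyᵇ (component s u ∩ only s)))
        no-only only only′ only-flip u with S u in e
        ... | true  = cong not (anyᵇ-cong λ x →
              trans (cong₂ _∧_ (trans (component-swapOn S s u x) (inside u e x)) (only-flip x))
                    (trans (∧-if (S x) (only′ s x) (only s x)) (cong (_∧ only′ s x) (sym (inside u e x)))))
        ... | false = cong not (anyᵇ-cong λ x → trans (cong₂ _∧_ (component-swapOn S s u x) (only-flip x)) (outer x))
          where
          outer : ∀ x → component s u x ∧ (if S x then only′ s x else only s x) ≡ component s u x ∧ only s x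
          outer x with component s u x in ux
          ... | false = refl
          ... | true rewrite outside u e x ux = refl

      pathEndˡ-flip : ∀ u → pathEndˡ s′ u ≡ (if S u then pathEndʳ s u else pathEndˡ s u)
      pathEndˡ-flip u rewrite onlyˡ-swapOn S s u | no-only onlyʳ onlyˡ (onlyʳ-swapOn S s) u with S u
      ... | true  = refl
      ... | false = refl

      pathEndʳ-flip : ∀ u → pathEndʳ s′ u ≡ (if S u then pathEndˡ s u else pathEndʳ s u)
      pathEndʳ-flip u rewrite onlyʳ-swapOn S s u | no-only onlyˡ onlyʳ (onlyˡ-swapOn S s) u with S u
      ... | true  = refl
      ... | false = refl

      flipAt-inside : ∀ u → S u ≡ true → flipAt s′ u ≡ s
      flipAt-inside u e = trans (swapOn-cong s′ (λ x → trans (component-swapOn S s u x) (inside u e x))) (swapOn-involutive S s)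

      flipAt-outside : ∀ u → S u ≡ false → flipAt s′ u ≡ swapOn (component s u) s′
      flipAt-outside u e = swapOn-cong s′ (component-swapOn S s u)

      flipAt-comm : ∀ u → S u ≡ false → swapOn (component s u) s′ ≡ swapOn S (flipAt s u)
      flipAt-comm u e = swapOn-comm (component s u) S s disjoint
        where
        disjoint : ∀ x → component s u x ∧ S x ≡ false
        disjoint x with component s u x in ux
        ... | false = refl
        ... | true  = outside u e x ux

    module PathEndCounts (s : Pair) (ms : MatchingPair s) where

      private
        noOnly-same : ∀ (only : Fin n → Bool) v u → component s v u ≡ true →
                      anyᵇ (component s u ∩ only) ≡ anyᵇ (component s v ∩ only)
        noOnly-same only v u e = anyᵇ-cong λ x → cong (_∧ only x) (component-same s ms v u e x)

      pathEndˡ-in-component : ∀ v → pathEndˡ s v ≡ true → count (component s v ∩ pathEndˡ s) ≡ 2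
      pathEndˡ-in-component v end = trans (count-cong same) (FlipLeftPath.onlyˡ-count≡2 s ms v end)
        where
        same : ∀ u → component s v u ∧ pathEndˡ s u ≡ component s v u ∧ onlyˡ s u
        same u with component s v u in e
        ... | false = refl
        ... | true rewrite noOnly-same (onlyʳ s) v u e | ∧-elimʳ {onlyˡ s v} end = ∧-identityʳ (onlyˡ s u)

      pathEndʳ-in-component : ∀ v → pathEndʳ s v ≡ true → count (component s v ∩ pathEndʳ s) ≡ 2
      pathEndʳ-in-component v end = trans (count-cong same) (FlipRightPath.onlyʳ-count≡2 s ms v end)
        where
        same : ∀ u → component s v u ∧ pathEndʳ s u ≡ component s v u ∧ onlyʳ s u
        same u with component s v u in e
        ... | false = refl
        ... | true rewrite noOnly-same (onlyˡ s) v u e | ∧-elimʳ {onlyʳ s v} end = ∧-identityʳ (onlyʳ s u)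

      private
        count-split : ∀ (o p : Fin n → Bool) → count o ≡ count (o ∩ p) + count (λ v → o v ∧ not (p v))
        count-split o p = trans (∑ℕ-cong λ v → pointwise (o v) (p v))
                                (∑ℕ-distrib-+ (toℕᵇ ∘ (o ∩ p)) (λ v → toℕᵇ (o v ∧ not (p v))))
          where
          pointwise : ∀ a b → toℕᵇ a ≡ toℕᵇ (a ∧ b) + toℕᵇ (a ∧ not b)
          pointwise true  true  = refl
          pointwise true  false = refl
          pointwise false _     = refl

        leaf-balance : count (onlyʳ s) + coverCount (proj₁ s) ≡ count (onlyˡ s) + coverCount (proj₂ s)
        leaf-balance = ∑ℕ-pointwise λ x → pointwise (coveredˡ s x) (coveredʳ s x)
          where
          pointwise : ∀ a b → toℕᵇ (b ∧ not a) + toℕᵇ a ≡ toℕᵇ (a ∧ not b) + toℕᵇ b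
          pointwise true  true  = refl
          pointwise true  false = refl
          pointwise false true  = refl
          pointwise false false = refl

        -- A component holds at most two leaves, so an o-vertex sees at most one o′-vertex in it.
        mixedEnds : ∀ (o o′ : Fin n → Bool) → (∀ v → o v ≡ true → count (component s v ∩ o) + count (component s v ∩ o′) ≤ 2) →
                    count (λ v → o v ∧ not (not (anyᵇ (component s v ∩ o′))))
                    ≡ ∑ℕ (λ v → ∑ℕ (λ u → toℕᵇ (o v ∧ (component s v u ∧ o′ u))))
        mixedEnds o o′ leaves≤2 = ∑ℕ-cong pointwise
          where
          pointwise : ∀ v → toℕᵇ (o v ∧ not (not (anyᵇ (component s v ∩ o′))))
                          ≡ ∑ℕ (λ u → toℕᵇ (o v ∧ (component s v u ∧ o′ u)))
          pointwise v with o v in e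
          ... | false = sym (∑ℕ-zero n)
          ... | true  = trans (cong toℕᵇ (not-involutive _)) (sym (count≤1 (component s v ∩ o′)
              (≤-pred (≤-trans (+-monoˡ-≤ _ (count-pos (component s v ∩ o) v (∧-intro (component-refl s v) e))) (leaves≤2 v e)))))

        leaves≤2 : ∀ v → leaf s v ≡ true → count (component s v ∩ onlyˡ s) + count (component s v ∩ onlyʳ s) ≤ 2
        leaves≤2 v lv = ≤-trans (≤-reflexive (sym (count-leaf (component s v) s))) (component-leaves≤2 s ms v lv)

        mixedˡ mixedʳ : ℕ
        mixedˡ = count (λ v → onlyˡ s v ∧ not (noOnlyʳ s v))
        mixedʳ = count (λ v → onlyʳ s v ∧ not (noOnlyˡ s v))

        mixedˡ≡mixedʳ : mixedˡ ≡ mixedʳ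
        mixedˡ≡mixedʳ = begin
          mixedˡ
            ≡⟨ mixedEnds (onlyˡ s) (onlyʳ s) (λ v e → leaves≤2 v (∨-introˡ e)) ⟩
          ∑ℕ (λ v → ∑ℕ (λ u → toℕᵇ (onlyˡ s v ∧ (component s v u ∧ onlyʳ s u))))
            ≡⟨ ∑ℕ-comm (λ v u → toℕᵇ (onlyˡ s v ∧ (component s v u ∧ onlyʳ s u))) ⟩
          ∑ℕ (λ u → ∑ℕ (λ v → toℕᵇ (onlyˡ s v ∧ (component s v u ∧ onlyʳ s u))))
            ≡⟨ ∑ℕ-cong (λ u → ∑ℕ-cong (λ v → cong toℕᵇ (reorder v u))) ⟩
          ∑ℕ (λ u → ∑ℕ (λ v → toℕᵇ (onlyʳ s u ∧ (component s u v ∧ onlyˡ s v))))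
            ≡⟨ sym (mixedEnds (onlyʳ s) (onlyˡ s) λ v e →
                 ≤-trans (≤-reflexive (+-comm (count (component s v ∩ onlyʳ s)) _)) (leaves≤2 v (∨-introʳ {onlyˡ s v} e))) ⟩
          mixedʳ ∎
          where
          open ≡-Reasoning
          reorder : ∀ v u → onlyˡ s v ∧ (component s v u ∧ onlyʳ s u) ≡ onlyʳ s u ∧ (component s u v ∧ onlyˡ s v)
          reorder v u rewrite ≡-by-⇔ (component-sym s ms v u) (component-sym s ms u v)
            with onlyˡ s v | onlyʳ s u | component s u v
          ... | true  | true  | _     = refl
          ... | true  | false | true  = refl
          ... | true  | false | false = refl
          ... | false | true  | true  = refl
          ... | false | true  | false = refl
          ... | false | false | _     = refl

      pathEnd-balance : count (pathEndʳ s) + coverCount (proj₁ s) ≡ count (pathEndˡ s) + coverCount (proj₂ s)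
      pathEnd-balance = +-cancelʳ-≡ mixedʳ _ _ (begin
        count (pathEndʳ s) + cov + mixedʳ     ≡⟨ +-assoc (count (pathEndʳ s)) cov mixedʳ ⟩
        count (pathEndʳ s) + (cov + mixedʳ)   ≡⟨ cong (count (pathEndʳ s) +_) (+-comm cov mixedʳ) ⟩
        count (pathEndʳ s) + (mixedʳ + cov)   ≡⟨ sym (+-assoc (count (pathEndʳ s)) mixedʳ cov) ⟩
        count (pathEndʳ s) + mixedʳ + cov     ≡⟨ cong (_+ cov) (sym (count-split (onlyʳ s) (noOnlyˡ s))) ⟩
        count (onlyʳ s) + cov                 ≡⟨ leaf-balance ⟩
        count (onlyˡ s) + cov′                ≡⟨ cong (_+ cov′) (count-split (onlyˡ s) (noOnlyʳ s)) ⟩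
        count (pathEndˡ s) + mixedˡ + cov′    ≡⟨ cong (λ z → count (pathEndˡ s) + z + cov′) mixedˡ≡mixedʳ ⟩
        count (pathEndˡ s) + mixedʳ + cov′    ≡⟨ +-assoc (count (pathEndˡ s)) mixedʳ cov′ ⟩
        count (pathEndˡ s) + (mixedʳ + cov′)  ≡⟨ cong (count (pathEndˡ s) +_) (+-comm mixedʳ cov′) ⟩
        count (pathEndˡ s) + (cov′ + mixedʳ)  ≡⟨ sym (+-assoc (count (pathEndˡ s)) cov′ mixedʳ) ⟩
        count (pathEndˡ s) + cov′ + mixedʳ    ∎)
        where
        open ≡-Reasoning
        cov cov′ : ℕ
        cov = coverCount (proj₁ s)
        cov′ = coverCount (proj₂ s)

module Operators {c ℓ} (F : Field c ℓ) (G : Graph) where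

  open import Data.Nat as ℕ using (ℕ; zero; suc)
  import Data.Nat.Properties as ℕ
  open import Data.Bool using (Bool; true; false; _∧_; not; if_then_else_)
  open import Data.Fin using (Fin; zero; suc)
  open import Data.Fin.Permutation using (Permutation′; _⟨$⟩ʳ_)
  open import Data.Product using (∃; _×_; _,_; proj₁; proj₂)
  open import Data.Nat.Solver using (module +-*-Solver)
  open +-*-Solver using (solve; _:+_; _:*_; _:=_; con)
  open import Data.Sum using (_⊎_; inj₁; inj₂)
  open import Function using (_∘_)
  open import Relation.Nullary using (¬_; yes; no; Dec)
  import Relation.Binary.PropositionalEquality as ≡
  open ≡ using (_≡_)
  open import Data.Empty using (⊥-elim)
  open import Algebra.Properties.CommutativeMonoid.Sum ℕ.+-0-commutativeMonoid
    using () renaming (sum to ∑ℕ; sum-cong-≋ to ∑ℕ-cong; ∑-distrib-+ to ∑ℕ-distrib-+; sum-replicate-zero to ∑ℕ-zero)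
  open Field F hiding (zero)
  open import Algebra.Properties.Semiring.Sum semiring
    using (sum; sum-cong-≋; sum-replicate; sum-replicate-zero; ∑-distrib-+; ∑-comm; ∑-permute; *-distribˡ-sum)
  open import Algebra.Properties.Monoid.Mult +-monoid using (×-congʳ; ×-homo-+)
  open import Algebra.Properties.Semiring.Mult semiring using (×-assoc-*)
  open import Relation.Binary.Reasoning.Setoid setoid
  open Combinatorics
  open MatchingPairs G
  open Graph G using (n)

  ×-zeroʳ : ∀ m → m ·ℕ 0# ≈ 0#
  ×-zeroʳ m = trans (sym (sum-replicate m)) (sum-replicate-zero m)

  ×-vanish : ∀ m {x} → x ≈ 0# → m ·ℕ x ≈ 0#
  ×-vanish m x≈0 = trans (×-congʳ m x≈0) (×-zeroʳ m)

  sum-vanish : ∀ {m} {f : Fin m → Carrier} → (∀ i → f i ≈ 0#) → sum f ≈ 0#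
  sum-vanish {m} h = trans (sum-cong-≋ h) (sum-replicate-zero m)

  sum-×ℕ : ∀ {m} (g : Fin m → ℕ) x → sum (λ i → g i ·ℕ x) ≈ ∑ℕ g ·ℕ x
  sum-×ℕ {zero}  g x = refl
  sum-×ℕ {suc m} g x = trans (+-congˡ (sum-×ℕ (g ∘ suc) x)) (sym (×-homo-+ x (g zero) (∑ℕ (g ∘ suc))))

  ×-cancel : CharZero F → ∀ m x → suc m ·ℕ x ≈ 0# → x ≈ 0#
  ×-cancel char0 m x e with inverse (suc m ·ℕ 1#) (char0 m)
  ... | y , m·y≈1 = begin
    x                        ≈⟨ sym (*-identityˡ x) ⟩
    1# * x                   ≈⟨ *-congʳ (sym m·y≈1) ⟩
    ((suc m ·ℕ 1#) * y) * x  ≈⟨ *-congʳ (*-comm _ y) ⟩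
    (y * (suc m ·ℕ 1#)) * x  ≈⟨ *-assoc y _ x ⟩
    y * ((suc m ·ℕ 1#) * x)  ≈⟨ *-congˡ (trans (×-assoc-* (suc m) 1# x) (×-congʳ (suc m) (*-identityˡ x))) ⟩
    y * (suc m ·ℕ x)         ≈⟨ *-congˡ e ⟩
    y * 0#                   ≈⟨ zeroʳ y ⟩
    0#                       ∎

  when : Bool → Carrier → Carrier
  when b x = if b then x else 0#

  when-cong : ∀ b {x y} → x ≈ y → when b x ≈ when b y
  when-cong true  e = e
  when-cong false e = refl

  when-+ : ∀ b x y → when b (x + y) ≈ when b x + when b y
  when-+ true  x y = refl
  when-+ false x y = sym (+-identityʳ 0#)

  when-* : ∀ b a x → when b (a * x) ≈ a * when b x
  when-* true  a x = refl
  when-* false a x = sym (zeroʳ a)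

  when-true : ∀ {b x} → b ≡ true → when b x ≡ x
  when-true ≡.refl = ≡.refl

  when-∧-false : ∀ {a} b x → a ≡ false → when (a ∧ b) x ≈ 0#
  when-∧-false b x ≡.refl = refl

  sum-when : ∀ {m} (p : Fin m → Bool) x → sum (λ i → when (p i) x) ≈ count p ·ℕ x
  sum-when {zero}  p x = refl
  sum-when {suc m} p x with p zero
  ... | true  = +-congˡ (sum-when (p ∘ suc) x)
  ... | false = trans (+-identityˡ _) (sum-when (p ∘ suc) x)

  Coeffs : Set c
  Coeffs = Coeff F G

  _∈_⊗_ : Coeffs → ℕ → ℕ → Set ℓ
  f ∈ a ⊗ b = InTensor F G a b f

  -- Reading f as Σ_s f s · x_s, transfer cd f is the image of f under x_t ↦ Σ_v [cd (flipAt t v) v] x_(flipAt t v);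
  -- for cd = pathEndˡ these are the exchanges along the paths of t with both end edges in M′,
  -- each counted once from each end.
  transfer : (Pair → Fin n → Bool) → Coeffs → Coeffs
  transfer cd f s = when (isMatchingPair s) (sum λ v → when (cd s v) (f (flipAt s v)))

  up down : Coeffs → Coeffs
  up   = transfer pathEndˡ
  down = transfer pathEndʳ

  module _ (cd : Pair → Fin n → Bool) where

    transfer-cong : ∀ {f g : Coeffs} → (∀ s → f s ≈ g s) → ∀ s → transfer cd f s ≈ transfer cd g s
    transfer-cong h s = when-cong (isMatchingPair s) (sum-cong-≋ λ v → when-cong (cd s v) (h (flipAt s v)))

    transfer-+ : ∀ (f g : Coeffs) s → transfer cd (λ t → f t + g t) s ≈ transfer cd f s + transfer cd g s
    transfer-+ f g s = trans (when-cong (isMatchingPair s)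
      (trans (sum-cong-≋ λ v → when-+ (cd s v) _ _) (∑-distrib-+ (λ v → when (cd s v) (f (flipAt s v))) _)))
      (when-+ (isMatchingPair s) _ _)

    transfer-* : ∀ a (f : Coeffs) s → transfer cd (λ t → a * f t) s ≈ a * transfer cd f s
    transfer-* a f s = trans (when-cong (isMatchingPair s)
      (trans (sum-cong-≋ λ v → when-* (cd s v) a _) (sym (*-distribˡ-sum a (λ v → when (cd s v) (f (flipAt s v)))))))
      (when-* (isMatchingPair s) a _)

    transfer-vanish : ∀ f s → (MatchingPair s → ∀ v → cd s v ≡ true → f (flipAt s v) ≈ 0#) → transfer cd f s ≈ 0#
    transfer-vanish f s h with isMatchingPair s in e
    ... | false = refl
    ... | true  = sum-vanish term
      where
      term : ∀ v → when (cd s v) (f (flipAt s v)) ≈ 0#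
      term v with cd s v in ecd
      ... | false = refl
      ... | true  = h (isMatchingPair-sound {s} e) v ecd

    transfer-×ℕ : ∀ m (f : Coeffs) s → transfer cd (λ t → m ·ℕ f t) s ≈ m ·ℕ transfer cd f s
    transfer-×ℕ zero    f s = transfer-vanish (λ _ → 0#) s λ _ _ _ → refl
    transfer-×ℕ (suc m) f s = trans (transfer-+ f (λ t → m ·ℕ f t) s) (+-congˡ (transfer-×ℕ m f s))

    transfer-invalid : ∀ f s → ¬ MatchingPair s → transfer cd f s ≈ 0#
    transfer-invalid f s ¬ms = transfer-vanish f s (λ ms → ⊥-elim (¬ms ms))

  matchingOfSize : ∀ {k M} → Matching M → edgeCount {n} M ≡ k → IsMatching G k M
  matchingOfSize (symM , edgeM , disjM) size = record { symmetric = symM ; edges = edgeM ; disjoint = disjM ; size = size }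

  up-into : ∀ a b f → f ∈ a ⊗ suc b → up f ∈ suc a ⊗ b
  up-into a b f f∈ s ¬s = transfer-vanish pathEndˡ f s λ ms v end → f∈ (flipAt s v) λ (m , m′) →
    let open FlipLeftPath s ms v end in
    ¬s ( matchingOfSize (proj₁ ms) (≡.trans (≡.sym edgeCountˡ-flip) (≡.trans (≡.cong (ℕ._+ 1) (IsMatching.size m)) (ℕ.+-comm a 1)))
       , matchingOfSize (proj₂ ms) (ℕ.+-cancelʳ-≡ 1 _ _ (≡.trans (≡.sym edgeCountʳ-flip) (≡.trans (IsMatching.size m′) (ℕ.+-comm 1 b)))))

  down-into : ∀ a b f → f ∈ suc a ⊗ b → down f ∈ a ⊗ suc b
  down-into a b f f∈ s ¬s = transfer-vanish pathEndʳ f s λ ms v end → f∈ (flipAt s v) λ (m , m′) →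
    let open FlipRightPath s ms v end in
    ¬s ( matchingOfSize (proj₁ ms) (ℕ.+-cancelʳ-≡ 1 _ _ (≡.trans (≡.sym edgeCountˡ-flip) (≡.trans (IsMatching.size m) (ℕ.+-comm 1 a))))
       , matchingOfSize (proj₂ ms) (≡.trans (≡.sym edgeCountʳ-flip) (≡.trans (≡.cong (ℕ._+ 1) (IsMatching.size m′)) (ℕ.+-comm b 1))))

  down-annihilates-0 : ∀ b f → f ∈ 0 ⊗ b → ∀ s → down f s ≈ 0#
  down-annihilates-0 b f f∈ s = transfer-vanish pathEndʳ f s λ ms v end → f∈ (flipAt s v) λ (m , _) →
    ℕ.1+n≢0 (≡.trans (ℕ.+-comm 1 _) (≡.trans (≡.sym (FlipRightPath.edgeCountˡ-flip s ms v end)) (IsMatching.size m)))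

  module _ (σ : Permutation′ n) (aut : IsAut G σ) where

    open PermutationAction σ

    transfer-equivariant : ∀ cd → (∀ s v → cd (actPair s) v ≡ cd s (σ ⟨$⟩ʳ v)) →
                           ∀ f s → transfer cd (act F G σ f) s ≈ act F G σ (transfer cd f) s
    transfer-equivariant cd cd-act f s = sym (begin
      when (isMatchingPair (actPair s)) (sum λ v → when (cd (actPair s) v) (f (flipAt (actPair s) v)))
        ≡⟨ ≡.cong (λ b → when b (sum λ v → when (cd (actPair s) v) (f (flipAt (actPair s) v)))) (isMatchingPair-act aut s) ⟩
      when (isMatchingPair s) (sum λ v → when (cd (actPair s) v) (f (flipAt (actPair s) v)))
        ≈⟨ when-cong (isMatchingPair s) (sum-cong-≋ λ v → reflexive (≡.cong₂ when (cd-act s v) (≡.cong f (flipAt-act s v)))) ⟩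
      when (isMatchingPair s) (sum λ v → g (σ ⟨$⟩ʳ v))
        ≈⟨ when-cong (isMatchingPair s) (sym (∑-permute g σ)) ⟩
      when (isMatchingPair s) (sum g) ∎)
      where
      g : Fin n → Carrier
      g v = when (cd s v) (f (actPair (flipAt s v)))

    up-equivariant : ∀ f s → up (act F G σ f) s ≈ act F G σ (up f) s
    up-equivariant = transfer-equivariant pathEndˡ pathEndˡ-act

  module TwoFlips (s : Pair) (ms : MatchingPair s) (cd cd′ : Pair → Fin n → Bool)
                  (flip-valid : ∀ v → cd s v ≡ true → MatchingPair (flipAt s v))
                  (cd′-flip : ∀ v u → cd′ (flipAt s v) u ≡ (if component s v u then cd s u else cd′ s u)) where

    sameComponentPairs : ℕ
    sameComponentPairs = ∑ℕ λ v → ∑ℕ λ u → toℕᵇ (cd s v ∧ (component s v u ∧ cd s u))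

    crossTerm : Coeffs → Carrier
    crossTerm f = sum λ v → sum λ u →
      when (cd s v ∧ (not (component s v u) ∧ cd′ s u)) (f (swapOn (component s u) (flipAt s v)))

    private
      module _ (f : Coeffs) (v : Fin n) where
        same cross : Fin n → Carrier
        same  u = when (cd s v ∧ (component s v u ∧ cd s u)) (f s)
        cross u = when (cd s v ∧ (not (component s v u) ∧ cd′ s u)) (f (swapOn (component s u) (flipAt s v)))

        second-flip : cd s v ≡ true → ∀ u → when (cd′ (flipAt s v) u) (f (flipAt (flipAt s v) u)) ≈ same u + cross u
        second-flip end u rewrite end | cd′-flip v u with component s v u in e
        ... | true  rewrite FlipComponent.flipAt-inside s ms v u e = sym (+-identityʳ _)
        ... | false rewrite FlipComponent.flipAt-outside s ms v u e = sym (+-identityˡ _)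

        first-flip : ∀ b → cd s v ≡ b → when b (transfer cd′ f (flipAt s v)) ≈ sum (λ u → same u + cross u)
        first-flip false e = sym (sum-vanish λ u → trans (+-cong (when-∧-false (component s v u ∧ cd s u) (f s) e)
                                                                 (when-∧-false (not (component s v u) ∧ cd′ s u) _ e)) (+-identityʳ 0#))
        first-flip true  e = trans (reflexive (when-true (isMatchingPair-true {flipAt s v} (flip-valid v e))))
                                   (sum-cong-≋ (second-flip e))

    transfer-twice : ∀ f → transfer cd (transfer cd′ f) s ≈ sameComponentPairs ·ℕ f s + crossTerm f
    transfer-twice f = begin
      transfer cd (transfer cd′ f) s
        ≡⟨ when-true (isMatchingPair-true {s} ms) ⟩
      sum (λ v → when (cd s v) (transfer cd′ f (flipAt s v)))
        ≈⟨ sum-cong-≋ (λ v → first-flip f v (cd s v) ≡.refl) ⟩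
      sum (λ v → sum (λ u → same f v u + cross f v u))
        ≈⟨ trans (sum-cong-≋ λ v → ∑-distrib-+ (same f v) (cross f v)) (∑-distrib-+ (sum ∘ same f) (sum ∘ cross f)) ⟩
      sum (λ v → sum (same f v)) + crossTerm f
        ≈⟨ +-congʳ (trans (sum-cong-≋ λ v → sum-when (λ u → cd s v ∧ (component s v u ∧ cd s u)) (f s))
                          (sum-×ℕ (λ v → count (λ u → cd s v ∧ (component s v u ∧ cd s u))) (f s))) ⟩
      sameComponentPairs ·ℕ f s + crossTerm f ∎

    sameComponentPairs≡ : (∀ v → cd s v ≡ true → count (component s v ∩ cd s) ≡ 2) →
                          sameComponentPairs ≡ count (cd s) ℕ.+ count (cd s)
    sameComponentPairs≡ pairs = ≡.trans (∑ℕ-cong λ v → per-vertex v (cd s v) ≡.refl)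
                                        (∑ℕ-distrib-+ (toℕᵇ ∘ cd s) (toℕᵇ ∘ cd s))
      where
      per-vertex : ∀ v b → cd s v ≡ b →
                   ∑ℕ (λ u → toℕᵇ (cd s v ∧ (component s v u ∧ cd s u))) ≡ toℕᵇ (cd s v) ℕ.+ toℕᵇ (cd s v)
      per-vertex v false e rewrite e = ∑ℕ-zero n
      per-vertex v true  e rewrite e = pairs v e

  IsMatching⇒Matching : ∀ {k M} → IsMatching G k M → Matching M
  IsMatching⇒Matching m = IsMatching.symmetric m , IsMatching.edges m , IsMatching.disjoint m

  ×-split : ∀ K L m {x} → x ≈ 0# ⊎ K ≡ L ℕ.+ m → K ·ℕ x ≈ L ·ℕ x + m ·ℕ x
  ×-split K L m (inj₁ x≈0) = trans (×-vanish K x≈0) (sym (trans (+-cong (×-vanish L x≈0) (×-vanish m x≈0)) (+-identityʳ 0#)))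
  ×-split K L m {x} (inj₂ ≡.refl) = ×-homo-+ x L m

  module _ (s : Pair) (ms : MatchingPair s) where

    private
      module DU = TwoFlips s ms pathEndʳ pathEndˡ (FlipRightPath.MatchingPair-flip s ms) (FlipComponent.pathEndˡ-flip s ms)
      module UD = TwoFlips s ms pathEndˡ pathEndʳ (FlipLeftPath.MatchingPair-flip s ms) (FlipComponent.pathEndʳ-flip s ms)
      open PathEndCounts s ms

    crossTerms-agree : ∀ f → UD.crossTerm f ≈ DU.crossTerm f
    crossTerms-agree f = trans (∑-comm (λ u v → when (pathEndˡ s u ∧ (not (component s u v) ∧ pathEndʳ s v))
                                                     (f (swapOn (component s v) (flipAt s u)))))
                                 (sum-cong-≋ λ v → sum-cong-≋ λ u → term v u)
      where
      term : ∀ v u → when (pathEndˡ s u ∧ (not (component s u v) ∧ pathEndʳ s v)) (f (swapOn (component s v) (flipAt s u)))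
                   ≈ when (pathEndʳ s v ∧ (not (component s v u) ∧ pathEndˡ s u)) (f (swapOn (component s u) (flipAt s v)))
      term v u rewrite ≡-by-⇔ (component-sym s ms u v) (component-sym s ms v u)
        with pathEndˡ s u | pathEndʳ s v | component s v u in e
      ... | true  | true  | false = reflexive (≡.cong f (≡.sym (FlipComponent.flipAt-comm s ms v u e)))
      ... | true  | true  | true  = refl
      ... | true  | false | true  = refl
      ... | true  | false | false = refl
      ... | false | true  | true  = refl
      ... | false | true  | false = refl
      ... | false | false | _     = refl

    sameComponentPairs-balance : ∀ a w → edgeCount {n} (proj₁ s) ≡ a → edgeCount {n} (proj₂ s) ≡ a ℕ.+ w →
                                 DU.sameComponentPairs ≡ UD.sameComponentPairs ℕ.+ 4 ℕ.* w
    sameComponentPairs-balance a w size size′ =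
      ≡.trans (DU.sameComponentPairs≡ pathEndʳ-in-component)
      (≡.trans (≡.cong (λ z → z ℕ.+ z) nʳ≡)
      (≡.trans (regroup nˡ w)
               (≡.cong (ℕ._+ 4 ℕ.* w) (≡.sym (UD.sameComponentPairs≡ pathEndˡ-in-component)))))
      where
      nʳ nˡ : ℕ
      nʳ = count (pathEndʳ s)
      nˡ = count (pathEndˡ s)
      regroup : ∀ x w → (x ℕ.+ 2 ℕ.* w) ℕ.+ (x ℕ.+ 2 ℕ.* w) ≡ (x ℕ.+ x) ℕ.+ 4 ℕ.* w
      regroup = solve 2 (λ x w → (x :+ con 2 :* w) :+ (x :+ con 2 :* w) := (x :+ x) :+ con 4 :* w) ≡.refl
      shift : ∀ x a w → x ℕ.+ 2 ℕ.* (a ℕ.+ w) ≡ (x ℕ.+ 2 ℕ.* w) ℕ.+ 2 ℕ.* a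
      shift = solve 3 (λ x a w → x :+ con 2 :* (a :+ w) := (x :+ con 2 :* w) :+ con 2 :* a) ≡.refl
      nʳ≡ : nʳ ≡ nˡ ℕ.+ 2 ℕ.* w
      nʳ≡ = ℕ.+-cancelʳ-≡ (2 ℕ.* a) _ _ (≡.trans (≡.subst₂ (λ p q → nʳ ℕ.+ p ≡ nˡ ℕ.+ q)
              (≡.trans (≡.sym (edgeCount-double (proj₁ s) (proj₁ ms))) (≡.cong (2 ℕ.*_) size))
              (≡.trans (≡.sym (edgeCount-double (proj₂ s) (proj₂ ms))) (≡.cong (2 ℕ.*_) size′)) pathEnd-balance)
              (shift nˡ a w))

    down-up-at : ∀ a w f → f ∈ a ⊗ (a ℕ.+ w) → down (up f) s ≈ up (down f) s + (4 ℕ.* w) ·ℕ f s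
    down-up-at a w f f∈ = begin
      down (up f) s                                                          ≈⟨ DU.transfer-twice f ⟩
      DU.sameComponentPairs ·ℕ f s + DU.crossTerm f
        ≈⟨ +-congʳ (×-split DU.sameComponentPairs UD.sameComponentPairs (4 ℕ.* w) weights) ⟩
      (UD.sameComponentPairs ·ℕ f s + (4 ℕ.* w) ·ℕ f s) + DU.crossTerm f     ≈⟨ +-assoc _ _ _ ⟩
      UD.sameComponentPairs ·ℕ f s + ((4 ℕ.* w) ·ℕ f s + DU.crossTerm f)     ≈⟨ +-congˡ (+-comm _ _) ⟩
      UD.sameComponentPairs ·ℕ f s + (DU.crossTerm f + (4 ℕ.* w) ·ℕ f s)     ≈⟨ sym (+-assoc _ _ _) ⟩
      (UD.sameComponentPairs ·ℕ f s + DU.crossTerm f) + (4 ℕ.* w) ·ℕ f s     ≈⟨ +-congʳ (+-congˡ (sym (crossTerms-agree f))) ⟩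
      (UD.sameComponentPairs ·ℕ f s + UD.crossTerm f) + (4 ℕ.* w) ·ℕ f s     ≈⟨ +-congʳ (sym (UD.transfer-twice f)) ⟩
      up (down f) s + (4 ℕ.* w) ·ℕ f s                                       ∎
      where
      weights : f s ≈ 0# ⊎ DU.sameComponentPairs ≡ UD.sameComponentPairs ℕ.+ 4 ℕ.* w
      weights with edgeCount {n} (proj₁ s) ℕ.≟ a | edgeCount {n} (proj₂ s) ℕ.≟ a ℕ.+ w
      ... | yes size | yes size′ = inj₂ (sameComponentPairs-balance a w size size′)
      ... | no ¬size | _         = inj₁ (f∈ s λ (m , _) → ¬size (IsMatching.size m))
      ... | yes _    | no ¬size′ = inj₁ (f∈ s λ (_ , m′) → ¬size′ (IsMatching.size m′))

  down-up : ∀ a w f → f ∈ a ⊗ (a ℕ.+ w) → ∀ s → down (up f) s ≈ up (down f) s + (4 ℕ.* w) ·ℕ f s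
  down-up a w f f∈ s = by-cases (matchingPair? s)
    where
    by-cases : Dec (MatchingPair s) → down (up f) s ≈ up (down f) s + (4 ℕ.* w) ·ℕ f s
    by-cases (yes ms) = down-up-at s ms a w f f∈
    by-cases (no ¬ms) = begin
      down (up f) s                      ≈⟨ transfer-invalid pathEndʳ (up f) s ¬ms ⟩
      0#                                 ≈⟨ sym (+-identityʳ 0#) ⟩
      0# + 0#                            ≈⟨ sym (+-cong (transfer-invalid pathEndˡ (down f) s ¬ms) (×-vanish (4 ℕ.* w) f≈0)) ⟩
      up (down f) s + (4 ℕ.* w) ·ℕ f s   ∎
      where
      f≈0 : f s ≈ 0#
      f≈0 = f∈ s λ (m , m′) → ¬ms (IsMatching⇒Matching m , IsMatching⇒Matching m′)

  down^ : ℕ → Coeffs → Coeffs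
  down^ zero    f = f
  down^ (suc j) f = down (down^ j f)

  -- By the commutation relation U D^(j+1) f = − κ j · D^j f with κ j ≠ 0; as D^(a+1) f = 0,
  -- descending in j gives f = 0.
  module UpKernel (char0 : CharZero F) (a w : ℕ) (f : Coeffs) (f∈ : f ∈ a ⊗ (a ℕ.+ suc w))
                  (up-f : ∀ s → up f s ≈ 0#) where

    gap : ℕ → ℕ
    gap j = suc w ℕ.+ (j ℕ.+ j)

    κ : ℕ → ℕ
    κ zero    = 4 ℕ.* gap 0
    κ (suc j) = κ j ℕ.+ 4 ℕ.* gap (suc j)

    κ-nonzero : ∀ j → ∃ λ k → κ j ≡ suc k
    κ-nonzero zero = _ , ≡.refl
    κ-nonzero (suc j) with κ-nonzero j
    ... | k , e rewrite e = _ , ≡.refl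

    down^-∈ : ∀ j r → j ℕ.+ r ≡ a → down^ j f ∈ r ⊗ (r ℕ.+ gap j)
    down^-∈ zero    r e = ≡.subst₂ (λ p q → f ∈ p ⊗ q) (≡.sym e) (≡.trans (initial-gap a w) (≡.cong (ℕ._+ gap 0) (≡.sym e))) f∈
      where
      initial-gap : ∀ a w → a ℕ.+ suc w ≡ a ℕ.+ (suc w ℕ.+ (0 ℕ.+ 0))
      initial-gap = solve 2 (λ a w → a :+ (con 1 :+ w) := a :+ ((con 1 :+ w) :+ (con 0 :+ con 0))) ≡.refl
    down^-∈ (suc j) r e = ≡.subst (λ q → down^ (suc j) f ∈ r ⊗ q) (next r w j)
      (down-into r (suc r ℕ.+ gap j) (down^ j f) (down^-∈ j (suc r) (≡.trans (ℕ.+-suc j r) e)))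
      where
      next : ∀ r w j → suc (suc r ℕ.+ (suc w ℕ.+ (j ℕ.+ j))) ≡ r ℕ.+ (suc w ℕ.+ (suc j ℕ.+ suc j))
      next = solve 3 (λ r w j → con 1 :+ (con 1 :+ r :+ (con 1 :+ w :+ (j :+ j)))
                            := r :+ (con 1 :+ w :+ ((con 1 :+ j) :+ (con 1 :+ j)))) ≡.refl

    up-down^ : ∀ j → j ℕ.≤ a → ∀ s → up (down^ (suc j) f) s + κ j ·ℕ down^ j f s ≈ 0#
    up-down^ zero    _   s = trans (sym (down-up a (gap 0) f (down^-∈ 0 a ≡.refl) s))
                                   (transfer-vanish pathEndʳ (up f) s λ _ v _ → up-f (flipAt s v))
    up-down^ (suc j) j<a s = begin
        up (down g) s + κ (suc j) ·ℕ g s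
      ≈⟨ +-congˡ (×-homo-+ (g s) (κ j) (4 ℕ.* gap (suc j))) ⟩
        up (down g) s + (κ j ·ℕ g s + (4 ℕ.* gap (suc j)) ·ℕ g s)
      ≈⟨ +-congˡ (+-comm _ _) ⟩
        up (down g) s + ((4 ℕ.* gap (suc j)) ·ℕ g s + κ j ·ℕ g s)
      ≈⟨ sym (+-assoc _ _ _) ⟩
        (up (down g) s + (4 ℕ.* gap (suc j)) ·ℕ g s) + κ j ·ℕ g s
      ≈⟨ +-congʳ (sym (down-up r (gap (suc j)) g (down^-∈ (suc j) r r+j≡a) s)) ⟩
        down (up g) s + κ j ·ℕ g s
      ≈⟨ +-congˡ (sym (transfer-×ℕ pathEndʳ (κ j) (down^ j f) s)) ⟩
        down (up g) s + down (λ t → κ j ·ℕ down^ j f t) s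
      ≈⟨ sym (transfer-+ pathEndʳ (up g) (λ t → κ j ·ℕ down^ j f t) s) ⟩
        down (λ t → up g t + κ j ·ℕ down^ j f t) s
      ≈⟨ transfer-vanish pathEndʳ (λ t → up g t + κ j ·ℕ down^ j f t) s (λ _ v _ → up-down^ j (ℕ.<⇒≤ j<a) (flipAt s v)) ⟩
        0# ∎
      where
      g : Coeffs
      g = down^ (suc j) f
      r : ℕ
      r = a ℕ.∸ suc j
      r+j≡a : suc j ℕ.+ r ≡ a
      r+j≡a = ℕ.m+[n∸m]≡n j<a

    down^-vanish-step : ∀ j → j ℕ.≤ a → (∀ s → down^ (suc j) f s ≈ 0#) → ∀ s → down^ j f s ≈ 0#
    down^-vanish-step j j≤a next-vanishes s with κ-nonzero j
    ... | k , κ≡ = ×-cancel char0 k (down^ j f s) (≡.subst (λ q → q ·ℕ down^ j f s ≈ 0#) κ≡ (begin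
      κ j ·ℕ down^ j f s                                   ≈⟨ sym (+-identityˡ _) ⟩
      0# + κ j ·ℕ down^ j f s
        ≈⟨ +-congʳ (sym (transfer-vanish pathEndˡ (down^ (suc j) f) s λ _ v _ → next-vanishes (flipAt s v))) ⟩
      up (down^ (suc j) f) s + κ j ·ℕ down^ j f s          ≈⟨ up-down^ j j≤a s ⟩
      0#                                                   ∎))

    down^-vanish : ∀ d j → j ℕ.+ d ≡ a → ∀ s → down^ j f s ≈ 0#
    down^-vanish zero    j e = down^-vanish-step j (ℕ.≤-reflexive j≡a)
      (≡.subst (λ q → ∀ s → down^ (suc q) f s ≈ 0#) (≡.sym j≡a)
               (down-annihilates-0 (0 ℕ.+ gap a) (down^ a f) (down^-∈ a 0 (ℕ.+-identityʳ a))))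
      where
      j≡a : j ≡ a
      j≡a = ≡.trans (≡.sym (ℕ.+-identityʳ j)) e
    down^-vanish (suc d) j e = down^-vanish-step j (ℕ.≤-trans (ℕ.m≤m+n j (suc d)) (ℕ.≤-reflexive e))
                                 (down^-vanish d (suc j) (≡.trans (≡.sym (ℕ.+-suc j d)) e))

    up-kernel-trivial : ∀ s → f s ≈ 0#
    up-kernel-trivial = down^-vanish a 0 ≡.refl

  up-injective : CharZero F → ∀ a w f g → f ∈ a ⊗ (a ℕ.+ suc w) → g ∈ a ⊗ (a ℕ.+ suc w) →
                 (∀ s → up f s ≈ up g s) → ∀ s → f s ≈ g s
  up-injective char0 a w f g f∈ g∈ up-f≈up-g s = x∙y⁻¹≈ε⇒x≈y (f s) (g s) (begin
      f s + - g s        ≈⟨ +-congˡ (sym (-1*x≈-x (g s))) ⟩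
      f-g s              ≈⟨ UpKernel.up-kernel-trivial char0 a w f-g f-g∈ up-f-g s ⟩
      0#                 ∎)
    where
    open import Algebra.Properties.Ring ring using (-1*x≈-x)
    open import Algebra.Properties.Group +-group using (x∙y⁻¹≈ε⇒x≈y)
    f-g : Coeffs
    f-g t = f t + - 1# * g t
    f-g∈ : f-g ∈ a ⊗ (a ℕ.+ suc w)
    f-g∈ t ¬t = trans (+-cong (f∈ t ¬t) (trans (*-congˡ (g∈ t ¬t)) (zeroʳ _))) (+-identityʳ 0#)
    up-f-g : ∀ s → up f-g s ≈ 0#
    up-f-g s = begin
      up f-g s                              ≈⟨ transfer-+ pathEndˡ f (λ t → - 1# * g t) s ⟩
      up f s + up (λ t → - 1# * g t) s      ≈⟨ +-cong (up-f≈up-g s) (trans (transfer-* pathEndˡ (- 1#) g s) (-1*x≈-x _)) ⟩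
      up g s + - up g s                     ≈⟨ -‿inverseʳ (up g s) ⟩
      0#                                    ∎

open import Data.Nat as ℕ using (ℕ; _≤_; _∸_; _+_)
import Data.Nat.Properties as ℕ
open import Relation.Binary.PropositionalEquality using (_≡_; subst; sym; cong; module ≡-Reasoning)

theorem1p3 : ∀ {c ℓ′} (F : Field c ℓ′) → CharZero F → (G : Graph) →
    ∀ (l k : ℕ) → 1 ≤ l → l ≤ k →
    InjEquivLinMap F G (l ∸ 1) (k + 1) l k
theorem1p3 F char0 G (ℕ.suc l′) k _ l≤k = record
  { φ           = up
  ; into        = λ f f∈ → up-into l′ k f (subst (f ∈ l′ ⊗_) (ℕ.+-comm k 1) f∈)
  ; respects    = λ f g _ _ → transfer-cong pathEndˡ
  ; additive    = λ f g _ _ → transfer-+ pathEndˡ f g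
  ; homogeneous = λ a f _ → transfer-* pathEndˡ a f
  ; injective   = λ f g f∈ g∈ → up-injective char0 l′ (ℕ.suc e) f g (subst (f ∈ l′ ⊗_) degree f∈) (subst (g ∈ l′ ⊗_) degree g∈)
  ; equivariant = λ σ aut f _ → up-equivariant σ aut f
  }
  where
  open Operators F G
  open Combinatorics.MatchingPairs G using (pathEndˡ)
  e : ℕ
  e = k ∸ ℕ.suc l′
  degree : k + 1 ≡ l′ + ℕ.suc (ℕ.suc e)
  degree = begin
    k + 1                   ≡⟨ ℕ.+-comm k 1 ⟩
    ℕ.suc k                 ≡⟨ cong ℕ.suc (sym (ℕ.m+[n∸m]≡n l≤k)) ⟩
    ℕ.suc (ℕ.suc l′ + e)    ≡⟨ cong ℕ.suc (sym (ℕ.+-suc l′ e)) ⟩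
    ℕ.suc (l′ + ℕ.suc e)    ≡⟨ sym (ℕ.+-suc l′ (ℕ.suc e)) ⟩
    l′ + ℕ.suc (ℕ.suc e)    ∎
    where open ≡-Reasoning
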